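{- Fix $e>0$ and let \[ \gamma^{(e)}_h=\sum_{j=0}^{h}(-1)^{h+j}\binom{2e+1}{h-j}\,y^{j+1}_{j+e+2},\qquad 0\leqslant h\leqslant 2e-1. \] Then \[ \sum_{i=0}^{2e-1}\gamma^{(e)}_i=(2e-1)!!\qquad\text{and}\qquad\sum_{i=0}^{2e-1}(i+1)\gamma^{(e)}_i=e\,(2e-1)!!. \]
   Context: Let $\mathbb{N}=\{0,1,2,\dots\}$ with $\mathbb{N}^n$ ordered componentwise. For $n,d\geqslant0$, $\mathrm P^n_d$ is the set of subsets $\lambda\subset\mathbb{N}^n$ of cardinality $d$ that are downward closed for the componentwise order. The degree of a point is the sum of its coordinates and $h_\lambda(i)$ is the number of points of $\lambda$ of degree $i$. $y^k_d$ is the number of $\lambda\in\mathrm P^k_d$ with $h_\lambda(1)=k$. -}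

module Defs where

open import Data.Nat as ℕ using (ℕ; zero; suc; _+_; _*_; _∸_; _≤_; _<_)
open import Data.Nat.Combinatorics using (_C_)
open import Data.Integer as ℤ using (ℤ; +_; -_)
open import Data.Vec using (Vec; []; _∷_)
open import Data.List using (List; []; _∷_; length; filter)
open import Data.List.Relation.Unary.Linked using (Linked)
open import Data.List.Relation.Unary.Unique.Propositional using (Unique)
open import Data.List.Membership.Propositional using (_∈_)
open import Data.Product using (_×_)
open import Function.Bundles using (_⇔_)
open import Relation.Binary.PropositionalEquality using (_≡_)
open import Data.Nat.Properties using (_≟_)

Point : ℕ → Set
Point n = Vec ℕ n

data _≤ᶜ_ : {n : ℕ} → Point n → Point n → Set where
  []  : [] ≤ᶜ []
  _∷_ : ∀ {n a b} {xs ys : Point n} → a ≤ b → xs ≤ᶜ ys → (a ∷ xs) ≤ᶜ (b ∷ ys)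

-- strict lexicographic order on ℕ^n (used only to give each finite
-- subset of ℕ^n a unique representation as a strictly sorted list)
data _<ˡ_ : {n : ℕ} → Point n → Point n → Set where
  here  : ∀ {n a b} {xs ys : Point n} → a < b → (a ∷ xs) <ˡ (b ∷ ys)
  there : ∀ {n a} {xs ys : Point n} → xs <ˡ ys → (a ∷ xs) <ˡ (a ∷ ys)

record FinSubset (n : ℕ) : Set where
  constructor mkFinSubset
  field
    elems  : List (Point n)
    sorted : Linked _<ˡ_ elems
open FinSubset public

degree : {n : ℕ} → Point n → ℕ
degree [] = 0
degree (x ∷ xs) = x + degree xs

card : {n : ℕ} → FinSubset n → ℕ
card λ' = length (elems λ')

DownClosed : {n : ℕ} → FinSubset n → Set
DownClosed {n} λ' = ∀ (x y : Point n) → x ∈ elems λ' → y ≤ᶜ x → y ∈ elems λ'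

InP : (n d : ℕ) → FinSubset n → Set
InP n d λ' = DownClosed λ' × card λ' ≡ d

h : {n : ℕ} → FinSubset n → ℕ → ℕ
h λ' i = length (filter (λ x → degree x ≟ i) (elems λ'))

-- "the number of elements A : FinSubset n satisfying P is m":
-- there is a duplicate-free list enumerating exactly those elements
-- (their elems lists, which determine them), of length m.
HasCount : {n : ℕ} → (FinSubset n → Set) → ℕ → Set
HasCount {n} P m =
  Σ' (List (FinSubset n)) (λ L → Unique L × (∀ A → (P A ⇔ (A ∈ L))) × length L ≡ m)
  where
  open import Data.Product using () renaming (Σ to Σ')

IsY : ℕ → ℕ → ℕ → Set
IsY k d m = HasCount (λ λ' → InP k d λ' × h λ' 1 ≡ k) m

_!! : ℕ → ℕ
zero !! = 1
suc zero !! = 1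
suc (suc n) !! = suc (suc n) * (n !!)

sumℤ : ℕ → (ℕ → ℤ) → ℤ
sumℤ zero f = + 0
sumℤ (suc n) f = sumℤ n f ℤ.+ f n

γ : (ℕ → ℕ → ℕ) → ℕ → ℕ → ℤ
γ y e hh = sumℤ (suc hh) (λ j →
  ((- + 1) ℤ.^ (hh + j)) ℤ.* (+ ((2 * e + 1) C (hh ∸ j))) ℤ.* (+ y (j + 1) (j + e + 2)))

{-# OPTIONS --safe #-}

-- Write f(n) = y^n_{n+e+1}.  Such a λ consists of the origin, the n unit vectors and e "extras", the
-- points of degree ≥ 2; a coordinate is used if some extra is positive there.  Let Q(n, b) count those
-- λ whose extras use each of the first b coordinates.  Splitting on whether coordinate b is used, and
-- deleting it when it is not, gives Q(n+1, b) = Q(n+1, b+1) + Q(n, b), so Q(a+b, b) is the b-th forward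
-- difference of f at a.  The γ⁽ᵉ⁾ₕ are the coefficients of (1 - x)^(2e+1) Σⱼ f(j+1) xʲ, hence (as f(0) = 0)
-- their sum is Q(2e, 2e) and the sum of their partial sums is Q(2e, 2e-1) = Q(2e, 2e) + Q(2e-1, 2e-1).
--
-- It remains to count the configurations T_e(n) = Q(n, n) with e extras using all n coordinates.  By
-- downward closure every used coordinate occurs in an extra of degree 2, so T_e(n) = 0 for n > 2e.
-- At the extremes n = 2e + 2 and n = 2e + 1 with e + 1 extras, slicing along the first coordinate
-- leaves few shapes: the first coordinate enters the extras only through e₀ + eⱼ, through e₀ + eⱼ and
-- e₀ + eₖ, or through 2e₀.  Hence T_{e+1}(2e+2) = (2e+1) T_e(2e) and
-- T_{e+1}(2e+1) = 2e (T_e(2e) + T_e(2e-1)) + C(2e, 2) T_{e-1}(2e-2) + T_e(2e),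
-- which give T_e(2e) = (2e-1)!! and T_e(2e-1) = e (2e-1)!!.

module Submission where

open import Defs
open import Data.Nat as ℕ using (ℕ; zero; suc; _+_; _*_; _∸_; _≤_; _<_; z≤n; s≤s; _≤?_; _<?_)
open import Data.Nat.Properties
open import Data.Nat.Combinatorics using (_C_; nCk+nC[k+1]≡[n+1]C[k+1]; k>n⇒nCk≡0; nC1≡n)
open import Data.Nat.ListAction using (sum)
open import Data.Nat.ListAction.Properties using (sum-++)
import Data.Nat.Tactic.RingSolver as ℕ-Solver
open import Data.Integer as ℤ using (ℤ; +_; -_) renaming (_+_ to _+ℤ_; _-_ to _-ℤ_; _*_ to _*ℤ_)
import Data.Integer.Properties as ℤP
open import Data.Integer.Tactic.RingSolver using (solve-∀)
open import Data.Fin as F using (Fin; punchIn; punchOut) renaming (zero to fz; suc to fs)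
import Data.Fin.Properties as FP
open import Data.Vec as V using (Vec; []; _∷_; lookup; insertAt; removeAt; replicate)
import Data.Vec.Properties as VP
open import Data.List as L using (List; []; _∷_; length; filter; map; _++_)
import Data.List.Properties as LP
open import Data.List.Relation.Unary.Any as Any using (here; there)
open import Data.List.Relation.Unary.All as All using (All; []; _∷_)
open import Data.List.Relation.Unary.AllPairs as AllPairs using (AllPairs; []; _∷_)
open import Data.List.Relation.Unary.Linked using (Linked; []; [-]; _∷_)
import Data.List.Relation.Unary.Linked.Properties as LinkedP
open import Data.List.Relation.Unary.Unique.Propositional using (Unique)
import Data.List.Relation.Unary.Unique.Propositional.Properties as UP
open import Data.List.Relation.Binary.Subset.Propositional using (_⊆_)
open import Data.List.Membership.Propositional using (_∈_; _∉_; find; lose)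
import Data.List.Membership.Propositional.Properties as MP
open import Data.Product using (∃; ∃₂; _×_; _,_; proj₁; proj₂)
open import Data.Sum using (_⊎_; inj₁; inj₂; [_,_]′)
open import Data.Empty using (⊥-elim)
open import Data.Unit using (⊤; tt)
open import Relation.Nullary using (¬_; Dec; yes; no; contradiction)
open import Relation.Nullary.Decidable using (¬?; _×-dec_; map′; recompute)
open import Relation.Unary using (Decidable)
open import Relation.Binary using (Tri; tri<; tri≈; tri>)
open import Relation.Binary.PropositionalEquality using (_≡_; _≢_; ≢-sym; refl; sym; trans; cong; cong₂; subst; module ≡-Reasoning)
open import Function using (_∘_; id; _∋_; flip; case_of_)
open import Function.Bundles using (_⇔_; mk⇔; Equivalence)

-- Counting with duplicate-free lists

module _ {A : Set} where

  ∈-++-∷⁻ : ∀ {x z : A} ys zs → z ∈ ys ++ x ∷ zs → z ≢ x → z ∈ ys ++ zs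
  ∈-++-∷⁻ []       zs (here z≡x)  z≢x = contradiction z≡x z≢x
  ∈-++-∷⁻ []       zs (there z∈)  z≢x = z∈
  ∈-++-∷⁻ (y ∷ ys) zs (here z≡y)  z≢x = here z≡y
  ∈-++-∷⁻ (y ∷ ys) zs (there z∈)  z≢x = there (∈-++-∷⁻ ys zs z∈ z≢x)

  length-++-∷ : ∀ {x : A} ys zs → length (ys ++ x ∷ zs) ≡ suc (length (ys ++ zs))
  length-++-∷ []       zs = refl
  length-++-∷ (y ∷ ys) zs = cong suc (length-++-∷ ys zs)

  length-mono-⊆ : {xs ys : List A} → Unique xs → xs ⊆ ys → length xs ≤ length ys
  length-mono-⊆ {[]}     _           _     = z≤n
  length-mono-⊆ {x ∷ xs} (x∉xs ∷ u) xs⊆ys with MP.∈-∃++ (xs⊆ys (here refl))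
  ... | ys₁ , ys₂ , refl = subst (suc (length xs) ≤_) (sym (length-++-∷ ys₁ ys₂))
    (s≤s (length-mono-⊆ u (λ z∈xs → ∈-++-∷⁻ ys₁ ys₂ (xs⊆ys (there z∈xs)) (λ { refl → All.lookup x∉xs z∈xs refl }))))

  length-cong-⊆ : {xs ys : List A} → Unique xs → Unique ys → xs ⊆ ys → ys ⊆ xs → length xs ≡ length ys
  length-cong-⊆ uxs uys xs⊆ys ys⊆xs = ≤-antisym (length-mono-⊆ uxs xs⊆ys) (length-mono-⊆ uys ys⊆xs)

  ⊆-length⇒⊇ : ((a b : A) → Dec (a ≡ b)) → {xs ys : List A} → Unique xs → xs ⊆ ys →
               length ys ≤ length xs → ys ⊆ xs
  ⊆-length⇒⊇ _≟_ {xs} {ys} uxs xs⊆ys ys≤xs {z} z∈ys with Any.any? (z ≟_) xs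
  ... | yes z∈xs = z∈xs
  ... | no  z∉xs = contradiction ys≤xs (<⇒≱ (length-mono-⊆ (z∉xs′ ∷ uxs) z∷xs⊆ys))
    where
    z∉xs′ : All (z ≢_) xs
    z∉xs′ = All.tabulate (λ { w∈xs refl → z∉xs w∈xs })
    z∷xs⊆ys : z ∷ xs ⊆ ys
    z∷xs⊆ys (here refl) = z∈ys
    z∷xs⊆ys (there w∈xs) = xs⊆ys w∈xs

  length-filter-∁ : {P : A → Set} (P? : Decidable P) (xs : List A) →
    length (filter P? xs) + length (filter (¬? ∘ P?) xs) ≡ length xs
  length-filter-∁ P? [] = refl
  length-filter-∁ P? (x ∷ xs) with P? x
  ... | yes _ = cong suc (length-filter-∁ P? xs)
  ... | no  _ = trans (+-suc _ _) (cong suc (length-filter-∁ P? xs))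

  length-filter-mono : {P Q : A → Set} (P? : Decidable P) (Q? : Decidable Q) → (∀ {x} → P x → Q x) →
    (xs : List A) → length (filter P? xs) ≤ length (filter Q? xs)
  length-filter-mono P? Q? P⇒Q [] = z≤n
  length-filter-mono P? Q? P⇒Q (x ∷ xs) with P? x | Q? x
  ... | yes _  | yes _  = s≤s (length-filter-mono P? Q? P⇒Q xs)
  ... | yes px | no ¬qx = contradiction (P⇒Q px) ¬qx
  ... | no _   | yes _  = m≤n⇒m≤1+n (length-filter-mono P? Q? P⇒Q xs)
  ... | no _   | no _   = length-filter-mono P? Q? P⇒Q xs

  length-filter-∪ : {P Q R : A → Set} (R? : Decidable R) (P? : Decidable P) (Q? : Decidable Q) →
    (∀ {x} → R x → P x ⊎ Q x) → (xs : List A) →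
    length (filter R? xs) ≤ length (filter P? xs) + length (filter Q? xs)
  length-filter-∪ R? P? Q? R⇒P∪Q [] = z≤n
  length-filter-∪ R? P? Q? R⇒P∪Q (x ∷ xs) with ih ← length-filter-∪ R? P? Q? R⇒P∪Q xs | R? x | P? x | Q? x
  ... | yes rx | no ¬px | no ¬qx = [ flip contradiction ¬px , flip contradiction ¬qx ]′ (R⇒P∪Q rx)
  ... | yes _  | yes _  | yes _  = s≤s (≤-trans ih (+-monoʳ-≤ _ (n≤1+n _)))
  ... | yes _  | yes _  | no _   = s≤s ih
  ... | yes _  | no _   | yes _  = ≤-trans (s≤s ih) (≤-reflexive (sym (+-suc _ _)))
  ... | no _   | yes _  | yes _  = ≤-trans ih (≤-trans (+-monoʳ-≤ _ (n≤1+n _)) (n≤1+n _))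
  ... | no _   | yes _  | no _   = m≤n⇒m≤1+n ih
  ... | no _   | no _   | yes _  = ≤-trans ih (+-monoʳ-≤ _ (n≤1+n _))
  ... | no _   | no _   | no _   = ih

  length-filter-map : {B : Set} {P : B → Set} (P? : Decidable P) (f : A → B) (xs : List A) →
    length (filter P? (map f xs)) ≡ length (filter (P? ∘ f) xs)
  length-filter-map P? f [] = refl
  length-filter-map P? f (x ∷ xs) with P? (f x)
  ... | yes _ = cong suc (length-filter-map P? f xs)
  ... | no  _ = length-filter-map P? f xs

  length-filter-≡ : {P : A → Set} (P? : Decidable P) {xs ys : List A} → Unique xs → Unique ys →
    (∀ {z} → z ∈ xs → P z → z ∈ ys) → (∀ {z} → z ∈ ys → z ∈ xs × P z) → length (filter P? xs) ≡ length ys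
  length-filter-≡ P? uxs uys to from = length-cong-⊆ (UP.filter⁺ P? uxs) uys
    (λ z∈ → let (z∈xs , pz) = MP.∈-filter⁻ P? z∈ in to z∈xs pz)
    (λ z∈ys → let (z∈xs , pz) = from z∈ys in MP.∈-filter⁺ P? z∈xs pz)

  length≡1⇒∈-≡ : {xs : List A} {x y : A} → length xs ≡ 1 → x ∈ xs → y ∈ xs → x ≡ y
  length≡1⇒∈-≡ {_ ∷ []} _ (here x≡z) (here y≡z) = trans x≡z (sym y≡z)

  length>0⇒∈ : {xs : List A} → 0 < length xs → ∃ (_∈ xs)
  length>0⇒∈ {x ∷ _} _ = x , here refl

  length≡2⇒ : {xs : List A} → length xs ≡ 2 → ∃₂ λ x y → xs ≡ x ∷ y ∷ []
  length≡2⇒ {x ∷ y ∷ []} _ = x , y , refl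

sum-map-const : {A : Set} (f : A → ℕ) {c : ℕ} (xs : List A) → (∀ {x} → x ∈ xs → f x ≡ c) → sum (map f xs) ≡ length xs * c
sum-map-const f []       _     = refl
sum-map-const f (x ∷ xs) f≡c = cong₂ _+_ (f≡c (here refl)) (sum-map-const f xs (f≡c ∘ there))

module _ {n : ℕ} where

  HasCount-unique : {P : FinSubset n → Set} {m m′ : ℕ} → HasCount P m → HasCount P m′ → m ≡ m′
  HasCount-unique (L , uL , P⇔L , refl) (L′ , uL′ , P⇔L′ , refl) = length-cong-⊆ uL uL′
    (λ {A} A∈L → Equivalence.to (P⇔L′ A) (Equivalence.from (P⇔L A) A∈L))
    (λ {A} A∈L′ → Equivalence.to (P⇔L A) (Equivalence.from (P⇔L′ A) A∈L′))

  HasCount-resp : {P Q : FinSubset n → Set} {m : ℕ} → (∀ {A} → P A → Q A) → (∀ {A} → Q A → P A) →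
    HasCount P m → HasCount Q m
  HasCount-resp P⇒Q Q⇒P (L , uL , P⇔L , len) =
    L , uL , (λ A → mk⇔ (Equivalence.to (P⇔L A) ∘ Q⇒P) (P⇒Q ∘ Equivalence.from (P⇔L A))) , len

  HasCount-filter : {P R : FinSubset n → Set} {m : ℕ} → (c : HasCount P m) → (R? : Decidable R) →
    HasCount (λ A → P A × R A) (length (filter R? (proj₁ c)))
  HasCount-filter (L , uL , P⇔L , _) R? = filter R? L , UP.filter⁺ R? uL , (λ A → mk⇔
    (λ (pA , rA) → MP.∈-filter⁺ R? (Equivalence.to (P⇔L A) pA) rA)
    (λ A∈ → let (A∈L , rA) = MP.∈-filter⁻ R? A∈ in Equivalence.from (P⇔L A) A∈L , rA)) , refl

  HasCount-partition : {P R : FinSubset n → Set} {m : ℕ} → HasCount P m → (R? : Decidable R) →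
    ∃₂ λ m₁ m₂ → HasCount (λ A → P A × R A) m₁ × HasCount (λ A → P A × ¬ R A) m₂ × m₁ + m₂ ≡ m
  HasCount-partition c@(L , _ , _ , refl) R? =
    _ , _ , HasCount-filter c R? , HasCount-filter c (¬? ∘ R?) , length-filter-∁ R? L

module _ {k n : ℕ} {I : Set} {P : FinSubset n → Set} {Q : I → FinSubset k → Set} {m : I → ℕ}
         (count-Q : ∀ i → HasCount (Q i) (m i))
         (Φ : I → FinSubset k → FinSubset n) (Ψ : I → FinSubset n → FinSubset k)
         (ΨΦ : ∀ i {A} → Q i A → Ψ i (Φ i A) ≡ A)
         (Φ-disjoint : ∀ i i′ {A A′} → Q i A → Q i′ A′ → Φ i A ≡ Φ i′ A′ → i ≡ i′) where

  private
    list : I → List (FinSubset k)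
    list i = proj₁ (count-Q i)

    ∈list⇔ : ∀ i A → Q i A ⇔ A ∈ list i
    ∈list⇔ i = proj₁ (proj₂ (proj₂ (count-Q i)))

    images : List I → List (FinSubset n)
    images []       = []
    images (i ∷ is) = map (Φ i) (list i) ++ images is

    ∈images⁻ : ∀ is {B} → B ∈ images is → ∃ λ i → i ∈ is × ∃ λ A → Q i A × B ≡ Φ i A
    ∈images⁻ (i ∷ is) B∈ with MP.∈-++⁻ (map (Φ i) (list i)) B∈
    ... | inj₁ B∈i  = let (A , A∈ , B≡) = MP.∈-map⁻ (Φ i) B∈i in
                      i , here refl , A , Equivalence.from (∈list⇔ i A) A∈ , B≡
    ... | inj₂ B∈is = let (i′ , i′∈ , A , qA , B≡) = ∈images⁻ is B∈is in i′ , there i′∈ , A , qA , B≡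

    ∈images⁺ : ∀ is {i A} → i ∈ is → Q i A → Φ i A ∈ images is
    ∈images⁺ (i ∷ is) {A = A} (here refl) qA = MP.∈-++⁺ˡ (MP.∈-map⁺ (Φ i) (Equivalence.to (∈list⇔ i A) qA))
    ∈images⁺ (j ∷ is) (there i∈) qA = MP.∈-++⁺ʳ (map (Φ j) (list j)) (∈images⁺ is i∈ qA)

    length-images : ∀ is → length (images is) ≡ sum (map m is)
    length-images []       = refl
    length-images (i ∷ is) = trans (LP.length-++ (map (Φ i) (list i)))
      (cong₂ _+_ (trans (LP.length-map (Φ i) (list i)) (proj₂ (proj₂ (proj₂ (count-Q i))))) (length-images is))

    Φ-injective : ∀ i {A A′} → A ∈ list i → A′ ∈ list i → Φ i A ≡ Φ i A′ → A ≡ A′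
    Φ-injective i {A} {A′} A∈ A′∈ eq = trans (sym (ΨΦ i (Equivalence.from (∈list⇔ i A) A∈)))
      (trans (cong (Ψ i) eq) (ΨΦ i (Equivalence.from (∈list⇔ i A′) A′∈)))

    map-unique : ∀ i {As} → Unique As → As ⊆ list i → Unique (map (Φ i) As)
    map-unique i {[]}     []         _  = []
    map-unique i {A ∷ As} (A∉ ∷ uAs) As⊆ = All.tabulate fresh ∷ map-unique i uAs (As⊆ ∘ there)
      where
      fresh : ∀ {B} → B ∈ map (Φ i) As → Φ i A ≢ B
      fresh B∈ eq with MP.∈-map⁻ (Φ i) B∈
      ... | (A′ , A′∈ , refl) = All.lookup A∉ A′∈ (Φ-injective i (As⊆ (here refl)) (As⊆ (there A′∈)) eq)

    images-unique : ∀ is → Unique is → Unique (images is)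
    images-unique []       []         = []
    images-unique (i ∷ is) (i∉ ∷ uis) =
      UP.++⁺ (map-unique i (proj₁ (proj₂ (count-Q i))) id) (images-unique is uis) disjoint
      where
      disjoint : ∀ {B} → ¬ (B ∈ map (Φ i) (list i) × B ∈ images is)
      disjoint (B∈i , B∈is) with MP.∈-map⁻ (Φ i) B∈i | ∈images⁻ is B∈is
      ... | (A , A∈ , refl) | (i′ , i′∈ , A′ , qA′ , eq) =
        All.lookup i∉ i′∈ (Φ-disjoint i i′ (Equivalence.from (∈list⇔ i A) A∈) qA′ eq)

  HasCount-⨆ : (is : List I) → Unique is →
    (∀ {i A} → i ∈ is → Q i A → P (Φ i A)) →
    (∀ {B} → P B → ∃ λ i → i ∈ is × Q i (Ψ i B) × Φ i (Ψ i B) ≡ B) →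
    HasCount P (sum (map m is))
  HasCount-⨆ is uis sound complete = images is , images-unique is uis , (λ B → mk⇔ to from) , length-images is
    where
    to : ∀ {B} → P B → B ∈ images is
    to pB with complete pB
    ... | (i , i∈ , qΨB , ΦΨB≡B) = subst (_∈ images is) ΦΨB≡B (∈images⁺ is i∈ qΨB)
    from : ∀ {B} → B ∈ images is → P B
    from B∈ with ∈images⁻ is B∈
    ... | (i , i∈ , A , qA , refl) = sound i∈ qA

HasCount-bijection : {k n : ℕ} {P : FinSubset n → Set} {Q : FinSubset k → Set} {m : ℕ} → HasCount Q m →
  (Φ : FinSubset k → FinSubset n) (Ψ : FinSubset n → FinSubset k) →
  (∀ {A} → Q A → Ψ (Φ A) ≡ A) → (∀ {A} → Q A → P (Φ A)) → (∀ {B} → P B → Q (Ψ B) × Φ (Ψ B) ≡ B) →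
  HasCount P m
HasCount-bijection {P = P} {m = m} count-Q Φ Ψ ΨΦ sound complete =
  subst (HasCount P) (+-identityʳ m)
    (HasCount-⨆ (λ _ → count-Q) (λ _ → Φ) (λ _ → Ψ) (λ _ → ΨΦ) (λ { tt tt _ _ _ → refl })
      (tt ∷ []) ([] ∷ []) (λ _ → sound) (λ pB → tt , here refl , complete pB))

-- Alternating binomial convolutions and finite differences

sign : ℕ → ℤ
sign k = (- + 1) ℤ.^ k

sign-suc : ∀ k → sign (suc k) ≡ - sign k
sign-suc k = ℤP.-1*i≡-i (sign k)

sign-suc-suc : ∀ k → sign (suc (suc k)) ≡ sign k
sign-suc-suc k = trans (sign-suc (suc k)) (trans (cong -_ (sign-suc k)) (ℤP.neg-involutive (sign k)))

sumℤ-cong : ∀ N {g g′ : ℕ → ℤ} → (∀ j → j < N → g j ≡ g′ j) → sumℤ N g ≡ sumℤ N g′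
sumℤ-cong zero     eq = refl
sumℤ-cong (suc N) eq = cong₂ _+ℤ_ (sumℤ-cong N (λ j j<N → eq j (m<n⇒m<1+n j<N))) (eq N (n<1+n N))

sumℤ-+ : ∀ N (g g′ : ℕ → ℤ) → sumℤ N (λ j → g j +ℤ g′ j) ≡ sumℤ N g +ℤ sumℤ N g′
sumℤ-+ zero    g g′ = refl
sumℤ-+ (suc N) g g′ = trans (cong (_+ℤ (g N +ℤ g′ N)) (sumℤ-+ N g g′)) (shuffle (sumℤ N g) (sumℤ N g′) (g N) (g′ N))
  where
  shuffle : ∀ a b c d → (a +ℤ b) +ℤ (c +ℤ d) ≡ (a +ℤ c) +ℤ (b +ℤ d)
  shuffle = solve-∀

sumℤ-neg : ∀ N (g : ℕ → ℤ) → sumℤ N (λ j → - g j) ≡ - sumℤ N g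
sumℤ-neg zero    g = refl
sumℤ-neg (suc N) g = trans (cong (_+ℤ - g N) (sumℤ-neg N g)) (sym (ℤP.neg-distrib-+ (sumℤ N g) (g N)))

sumℤ-suc : ∀ N (g : ℕ → ℤ) → sumℤ (suc N) g ≡ g 0 +ℤ sumℤ N (g ∘ suc)
sumℤ-suc zero    g = trans (ℤP.+-identityˡ (g 0)) (sym (ℤP.+-identityʳ (g 0)))
sumℤ-suc (suc N) g = trans (cong (_+ℤ g (suc N)) (sumℤ-suc N g)) (ℤP.+-assoc (g 0) _ (g (suc N)))

-- binConv M g h is the coefficient of x ^ h in (1 - x) ^ M * Σⱼ g j * x ^ j.
binConv : ℕ → (ℕ → ℤ) → ℕ → ℤ
binConv M g h = sumℤ (suc h) (λ j → sign (h + j) *ℤ + (M C (h ∸ j)) *ℤ g j)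

binConv-cong : ∀ M {g g′ : ℕ → ℤ} h → (∀ j → g j ≡ g′ j) → binConv M g h ≡ binConv M g′ h
binConv-cong M h eq = sumℤ-cong (suc h) (λ j _ → cong (sign (h + j) *ℤ + (M C (h ∸ j)) *ℤ_) (eq j))

binConv-zero : ∀ M (g : ℕ → ℤ) → binConv M g 0 ≡ g 0
binConv-zero M g = trans (ℤP.+-identityˡ _) (ℤP.*-identityˡ (g 0))

binConv-suc : ∀ M (g : ℕ → ℤ) h → + (M C suc h) *ℤ g 0 ≡ + 0 → binConv M g (suc h) ≡ binConv M (g ∘ suc) h
binConv-suc M g h leading≡0 = begin
  binConv M g (suc h)                            ≡⟨ sumℤ-suc (suc h) _ ⟩
  term +ℤ sumℤ (suc h) (λ j → sign (suc h + suc j) *ℤ + (M C (h ∸ j)) *ℤ g (suc j))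
    ≡⟨ cong₂ _+ℤ_ term≡0 (sumℤ-cong (suc h) (λ j _ → cong (λ s → s *ℤ + (M C (h ∸ j)) *ℤ g (suc j)) (sign-shift j))) ⟩
  + 0 +ℤ binConv M (g ∘ suc) h                   ≡⟨ ℤP.+-identityˡ _ ⟩
  binConv M (g ∘ suc) h                          ∎
  where
  open ≡-Reasoning
  term = sign (suc h + 0) *ℤ + (M C suc h) *ℤ g 0
  term≡0 : term ≡ + 0
  term≡0 = trans (ℤP.*-assoc (sign (suc h + 0)) _ (g 0))
                 (trans (cong (sign (suc h + 0) *ℤ_) leading≡0) (ℤP.*-zeroʳ (sign (suc h + 0))))
  sign-shift : ∀ j → sign (suc h + suc j) ≡ sign (h + j)
  sign-shift j = trans (cong (sign ∘ suc) (+-suc h j)) (sign-suc-suc (h + j))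

binConv-pascal : ∀ M (g : ℕ → ℤ) h → binConv (suc M) g (suc h) ≡ binConv M g (suc h) -ℤ binConv M g h
binConv-pascal M g h = begin
  sumℤ (suc h) t +ℤ t (suc h)                            ≡⟨ cong₂ _+ℤ_ (sumℤ-cong (suc h) t≡a-b) last ⟩
  sumℤ (suc h) (λ j → a j +ℤ - b j) +ℤ a (suc h)        ≡⟨ cong (_+ℤ a (suc h)) (sumℤ-+ (suc h) a (-_ ∘ b)) ⟩
  (sumℤ (suc h) a +ℤ sumℤ (suc h) (-_ ∘ b)) +ℤ a (suc h) ≡⟨ cong (λ z → (sumℤ (suc h) a +ℤ z) +ℤ a (suc h)) (sumℤ-neg (suc h) b) ⟩
  (sumℤ (suc h) a -ℤ binConv M g h) +ℤ a (suc h)          ≡⟨ swap (sumℤ (suc h) a) (binConv M g h) (a (suc h)) ⟩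
  binConv M g (suc h) -ℤ binConv M g h                    ∎
  where
  open ≡-Reasoning
  t a b : ℕ → ℤ
  t j = sign (suc h + j) *ℤ + (suc M C (suc h ∸ j)) *ℤ g j
  a j = sign (suc h + j) *ℤ + (M C (suc h ∸ j)) *ℤ g j
  b j = sign (h + j) *ℤ + (M C (h ∸ j)) *ℤ g j
  split : ∀ s c c′ x → - s *ℤ (c +ℤ c′) *ℤ x ≡ - s *ℤ c′ *ℤ x +ℤ - (s *ℤ c *ℤ x)
  split = solve-∀
  swap : ∀ A B x → (A -ℤ B) +ℤ x ≡ (A +ℤ x) -ℤ B
  swap = solve-∀
  t≡a-b : ∀ j → j < suc h → t j ≡ a j +ℤ - b j
  t≡a-b j j≤h = begin
    sign (suc (h + j)) *ℤ + (suc M C (suc h ∸ j)) *ℤ g j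
      ≡⟨ cong (λ k → sign (suc (h + j)) *ℤ + (suc M C k) *ℤ g j) suc[h∸j] ⟩
    sign (suc (h + j)) *ℤ + (suc M C suc (h ∸ j)) *ℤ g j
      ≡⟨ cong₂ (λ s c → s *ℤ + c *ℤ g j) (sign-suc (h + j)) (sym (nCk+nC[k+1]≡[n+1]C[k+1] M (h ∸ j))) ⟩
    - sign (h + j) *ℤ + (M C (h ∸ j) + M C suc (h ∸ j)) *ℤ g j
      ≡⟨ cong (λ c → - sign (h + j) *ℤ c *ℤ g j) (ℤP.pos-+ (M C (h ∸ j)) _) ⟩
    - sign (h + j) *ℤ (+ (M C (h ∸ j)) +ℤ + (M C suc (h ∸ j))) *ℤ g j
      ≡⟨ split (sign (h + j)) _ _ (g j) ⟩
    - sign (h + j) *ℤ + (M C suc (h ∸ j)) *ℤ g j +ℤ - b j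
      ≡⟨ cong₂ (λ s k → s *ℤ + (M C k) *ℤ g j +ℤ - b j) (sym (sign-suc (h + j))) (sym suc[h∸j]) ⟩
    a j +ℤ - b j ∎
    where
    suc[h∸j] : suc h ∸ j ≡ suc (h ∸ j)
    suc[h∸j] = +-∸-assoc 1 (≤-pred j≤h)
  last : t (suc h) ≡ a (suc h)
  last = trans (cong (λ k → sign (suc h + suc h) *ℤ + (suc M C k) *ℤ g (suc h)) (n∸n≡0 h))
               (sym (cong (λ k → sign (suc h + suc h) *ℤ + (M C k) *ℤ g (suc h)) (n∸n≡0 h)))

sum-binConv : ∀ M (g : ℕ → ℤ) h → sumℤ (suc h) (binConv (suc M) g) ≡ binConv M g h
sum-binConv M g zero    = trans (ℤP.+-identityˡ _) (trans (binConv-zero (suc M) g) (sym (binConv-zero M g)))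
sum-binConv M g (suc h) = begin
  sumℤ (suc h) (binConv (suc M) g) +ℤ binConv (suc M) g (suc h)
    ≡⟨ cong₂ _+ℤ_ (sum-binConv M g h) (binConv-pascal M g h) ⟩
  binConv M g h +ℤ (binConv M g (suc h) -ℤ binConv M g h)
    ≡⟨ telescope (binConv M g h) (binConv M g (suc h)) ⟩
  binConv M g (suc h) ∎
  where
  open ≡-Reasoning
  telescope : ∀ x y → x +ℤ (y -ℤ x) ≡ y
  telescope = solve-∀

sumℤ-weighted : ∀ N (g : ℕ → ℤ) →
  sumℤ (suc N) (λ i → sumℤ i g) +ℤ sumℤ N (λ h → + (h + 1) *ℤ g h) ≡ + (N + 1) *ℤ sumℤ N g
sumℤ-weighted zero    g = refl
sumℤ-weighted (suc N) g = begin
  (P +ℤ (S +ℤ g N)) +ℤ (W +ℤ k *ℤ g N) ≡⟨ regroup P S W (g N) k ⟩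
  (P +ℤ W) +ℤ (S +ℤ g N +ℤ k *ℤ g N)   ≡⟨ cong (_+ℤ (S +ℤ g N +ℤ k *ℤ g N)) (sumℤ-weighted N g) ⟩
  k *ℤ S +ℤ (S +ℤ g N +ℤ k *ℤ g N)     ≡⟨ factor k S (g N) ⟩
  (k +ℤ + 1) *ℤ (S +ℤ g N)             ≡⟨ cong (λ m → + m *ℤ (S +ℤ g N)) (+-comm (N + 1) 1) ⟩
  + (suc N + 1) *ℤ (S +ℤ g N)          ∎
  where
  open ≡-Reasoning
  P = sumℤ (suc N) (λ i → sumℤ i g)
  S = sumℤ N g
  W = sumℤ N (λ h → + (h + 1) *ℤ g h)
  k = + (N + 1)
  regroup : ∀ P S W x k → (P +ℤ (S +ℤ x)) +ℤ (W +ℤ k *ℤ x) ≡ (P +ℤ W) +ℤ (S +ℤ x +ℤ k *ℤ x)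
  regroup = solve-∀
  factor : ∀ k S x → k *ℤ S +ℤ (S +ℤ x +ℤ k *ℤ x) ≡ (k +ℤ + 1) *ℤ (S +ℤ x)
  factor = solve-∀

sumℤ-weighted-value : ∀ N (g : ℕ → ℤ) {s p w : ℕ} → sumℤ N g ≡ + s → sumℤ (suc N) (λ i → sumℤ i g) ≡ + p →
  (N + 1) * s ≡ p + w → sumℤ N (λ h → + (h + 1) *ℤ g h) ≡ + w
sumℤ-weighted-value N g {s} {p} {w} S≡s P≡p total = begin
  W                                                ≡⟨ cancel (+ p) W ⟨
  (+ p +ℤ W) -ℤ + p                                ≡⟨ cong (λ x → (x +ℤ W) -ℤ + p) P≡p ⟨
  (sumℤ (suc N) (λ i → sumℤ i g) +ℤ W) -ℤ + p       ≡⟨ cong (_-ℤ + p) (sumℤ-weighted N g) ⟩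
  + (N + 1) *ℤ sumℤ N g -ℤ + p                      ≡⟨ cong (λ x → + (N + 1) *ℤ x -ℤ + p) S≡s ⟩
  + (N + 1) *ℤ + s -ℤ + p                           ≡⟨ cong (_-ℤ + p) (ℤP.pos-* (N + 1) s) ⟨
  + ((N + 1) * s) -ℤ + p                            ≡⟨ cong (λ x → + x -ℤ + p) total ⟩
  + (p + w) -ℤ + p                                  ≡⟨ cong (_-ℤ + p) (ℤP.pos-+ p w) ⟩
  (+ p +ℤ + w) -ℤ + p                               ≡⟨ cancel (+ p) (+ w) ⟩
  + w                                              ∎
  where
  open ≡-Reasoning
  W = sumℤ N (λ h → + (h + 1) *ℤ g h)
  cancel : ∀ x y → (x +ℤ y) -ℤ x ≡ y
  cancel = solve-∀

module FiniteDifference (f : ℕ → ℕ) (Q : ℕ → ℕ → ℕ)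
  (Q-zero : ∀ n → Q n 0 ≡ f n)
  (Q-suc : ∀ n b → b ≤ n → Q (suc n) b ≡ Q (suc n) (suc b) + Q n b) where

  -- binConv b (λ j → + f (a + j)) b is the b-th forward difference of f at a.
  Q≡binConv : ∀ b a → + Q (b + a) b ≡ binConv b (λ j → + f (a + j)) b
  Q≡binConv zero a = begin
    + Q a 0                          ≡⟨ cong +_ (trans (Q-zero a) (cong f (sym (+-identityʳ a)))) ⟩
    + f (a + 0)                      ≡⟨ binConv-zero 0 (λ j → + f (a + j)) ⟨
    binConv 0 (λ j → + f (a + j)) 0  ∎
    where open ≡-Reasoning
  Q≡binConv (suc b) a = begin
    + Q (suc (b + a)) (suc b)                       ≡⟨ difference (Q-suc (b + a) b (m≤m+n b a)) ⟩
    + Q (suc (b + a)) b -ℤ + Q (b + a) b             ≡⟨ cong (λ n → + Q n b -ℤ + Q (b + a) b) (sym (+-suc b a)) ⟩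
    + Q (b + suc a) b -ℤ + Q (b + a) b               ≡⟨ cong₂ _-ℤ_ (Q≡binConv b (suc a)) (Q≡binConv b a) ⟩
    binConv b (λ j → + f (suc a + j)) b -ℤ binConv b G b ≡⟨ cong (_-ℤ binConv b G b) (sym shifted) ⟩
    binConv b G (suc b) -ℤ binConv b G b             ≡⟨ binConv-pascal b G b ⟨
    binConv (suc b) G (suc b)                       ∎
    where
    open ≡-Reasoning
    G : ℕ → ℤ
    G j = + f (a + j)
    difference : ∀ {m n k} → m ≡ n + k → + n ≡ + m -ℤ + k
    difference {n = n} {k} refl = trans (cancel (+ n) (+ k)) (cong (_-ℤ + k) (sym (ℤP.pos-+ n k)))
      where
      cancel : ∀ x y → x ≡ (x +ℤ y) -ℤ y
      cancel = solve-∀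
    shifted : binConv b G (suc b) ≡ binConv b (λ j → + f (suc a + j)) b
    shifted = trans (binConv-suc b G b (cong (_*ℤ G 0) (cong +_ (k>n⇒nCk≡0 (n<1+n b)))))
                    (binConv-cong b b (λ j → cong (+_ ∘ f) (+-suc a j)))

  module _ (f-zero : f 0 ≡ 0) (N₀ : ℕ) where
    private
      F Γ : ℕ → ℤ
      F j = + f (suc j)
      Γ = binConv (suc (suc N₀)) F

    sum-binConv≡Q : sumℤ (suc N₀) Γ ≡ + Q (suc N₀) (suc N₀)
    sum-binConv≡Q = begin
      sumℤ (suc N₀) Γ                          ≡⟨ sum-binConv (suc N₀) F N₀ ⟩
      binConv (suc N₀) F N₀                    ≡⟨ binConv-suc (suc N₀) (+_ ∘ f) N₀ leading≡0 ⟨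
      binConv (suc N₀) (+_ ∘ f) (suc N₀)       ≡⟨ Q≡binConv (suc N₀) 0 ⟨
      + Q (suc N₀ + 0) (suc N₀)                ≡⟨ cong (λ n → + Q n (suc N₀)) (+-identityʳ (suc N₀)) ⟩
      + Q (suc N₀) (suc N₀)                    ∎
      where
      open ≡-Reasoning
      leading≡0 : + (suc N₀ C suc N₀) *ℤ + f 0 ≡ + 0
      leading≡0 = trans (cong (λ x → + (suc N₀ C suc N₀) *ℤ + x) f-zero) (ℤP.*-zeroʳ (+ (suc N₀ C suc N₀)))

    sum-partialSums≡Q : sumℤ (suc (suc N₀)) (λ i → sumℤ i Γ) ≡ + (Q (suc N₀) (suc N₀) + Q N₀ N₀)
    sum-partialSums≡Q = begin
      sumℤ (suc (suc N₀)) (λ i → sumℤ i Γ)       ≡⟨ sumℤ-suc (suc N₀) (λ i → sumℤ i Γ) ⟩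
      + 0 +ℤ sumℤ (suc N₀) (λ i → sumℤ (suc i) Γ) ≡⟨ ℤP.+-identityˡ _ ⟩
      sumℤ (suc N₀) (λ i → sumℤ (suc i) Γ)        ≡⟨ sumℤ-cong (suc N₀) (λ i _ → sum-binConv (suc N₀) F i) ⟩
      sumℤ (suc N₀) (binConv (suc N₀) F)         ≡⟨ sum-binConv N₀ F N₀ ⟩
      binConv N₀ F N₀                           ≡⟨ Q≡binConv N₀ 1 ⟨
      + Q (N₀ + 1) N₀                           ≡⟨ cong (λ n → + Q n N₀) (+-comm N₀ 1) ⟩
      + Q (suc N₀) N₀                           ≡⟨ cong +_ (Q-suc N₀ N₀ ≤-refl) ⟩
      + (Q (suc N₀) (suc N₀) + Q N₀ N₀)          ∎
      where open ≡-Reasoning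

-- Finite subsets of ℕⁿ as sorted lists

<ˡ-trans : {n : ℕ} {x y z : Point n} → x <ˡ y → y <ˡ z → x <ˡ z
<ˡ-trans (here a<b)  (here b<c)  = here (<-trans a<b b<c)
<ˡ-trans (here a<b)  (there _)   = here a<b
<ˡ-trans (there _)   (here b<c)  = here b<c
<ˡ-trans (there x<y) (there y<z) = there (<ˡ-trans x<y y<z)

<ˡ-irrefl : {n : ℕ} {x : Point n} → ¬ x <ˡ x
<ˡ-irrefl (here a<a)  = <-irrefl refl a<a
<ˡ-irrefl (there x<x) = <ˡ-irrefl x<x

<ˡ-asym : {n : ℕ} {x y : Point n} → x <ˡ y → ¬ y <ˡ x
<ˡ-asym x<y y<x = <ˡ-irrefl (<ˡ-trans x<y y<x)

<ˡ⇒≢ : {n : ℕ} {x y : Point n} → x <ˡ y → x ≢ y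
<ˡ⇒≢ x<y refl = <ˡ-irrefl x<y

<ˡ-irrelevant : {n : ℕ} {x y : Point n} (p q : x <ˡ y) → p ≡ q
<ˡ-irrelevant (here p)  (here q)  = cong here (<-irrelevant p q)
<ˡ-irrelevant (here p)  (there _) = contradiction p (<-irrefl refl)
<ˡ-irrelevant (there _) (here q)  = contradiction q (<-irrefl refl)
<ˡ-irrelevant (there p) (there q) = cong there (<ˡ-irrelevant p q)

Linked-irrelevant : {n : ℕ} {xs : List (Point n)} (p q : Linked _<ˡ_ xs) → p ≡ q
Linked-irrelevant []      []        = refl
Linked-irrelevant [-]     [-]       = refl
Linked-irrelevant (r ∷ p) (r′ ∷ q) = cong₂ _∷_ (<ˡ-irrelevant r r′) (Linked-irrelevant p q)

<ˡ-cmp : {n : ℕ} (x y : Point n) → Tri (x <ˡ y) (x ≡ y) (y <ˡ x)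
<ˡ-cmp [] [] = tri≈ (λ ()) refl (λ ())
<ˡ-cmp (a ∷ x) (b ∷ y) with <-cmp a b
... | tri< a<b _ _ = tri< (here a<b) (<ˡ⇒≢ (here a<b)) (<ˡ-asym (here a<b))
... | tri> _ _ b<a = tri> (<ˡ-asym (here b<a)) (≢-sym (<ˡ⇒≢ (here b<a))) (here b<a)
... | tri≈ _ refl _ with <ˡ-cmp x y
...   | tri< x<y _ _ = tri< (there x<y) (<ˡ⇒≢ (there x<y)) (<ˡ-asym (there x<y))
...   | tri≈ _ refl _ = tri≈ <ˡ-irrefl refl <ˡ-irrefl
...   | tri> _ _ y<x = tri> (<ˡ-asym (there y<x)) (≢-sym (<ˡ⇒≢ (there y<x))) (there y<x)

Sorted : {n : ℕ} → List (Point n) → Set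
Sorted = AllPairs _<ˡ_

module _ {n : ℕ} where

  insert : Point n → List (Point n) → List (Point n)
  insert x []       = x ∷ []
  insert x (y ∷ ys) with <ˡ-cmp x y
  ... | tri< _ _ _ = x ∷ y ∷ ys
  ... | tri≈ _ _ _ = y ∷ ys
  ... | tri> _ _ _ = y ∷ insert x ys

  ∈-insert⁻ : ∀ {x z} ys → z ∈ insert x ys → z ≡ x ⊎ z ∈ ys
  ∈-insert⁻ []                 (here z≡x) = inj₁ z≡x
  ∈-insert⁻ {x} (y ∷ ys) z∈ with <ˡ-cmp x y | z∈
  ... | tri< _ _ _ | here z≡x  = inj₁ z≡x
  ... | tri< _ _ _ | there z∈′ = inj₂ z∈′
  ... | tri≈ _ _ _ | z∈′       = inj₂ z∈′
  ... | tri> _ _ _ | here z≡y  = inj₂ (here z≡y)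
  ... | tri> _ _ _ | there z∈′ = [ inj₁ , inj₂ ∘ there ]′ (∈-insert⁻ ys z∈′)

  ∈-insert⁺ˡ : ∀ {x} ys → x ∈ insert x ys
  ∈-insert⁺ˡ []             = here refl
  ∈-insert⁺ˡ {x} (y ∷ ys) with <ˡ-cmp x y
  ... | tri< _ _ _   = here refl
  ... | tri≈ _ x≡y _ = here x≡y
  ... | tri> _ _ _   = there (∈-insert⁺ˡ ys)

  ∈-insert⁺ʳ : ∀ {x z} ys → z ∈ ys → z ∈ insert x ys
  ∈-insert⁺ʳ {x} (y ∷ ys) z∈ with <ˡ-cmp x y | z∈
  ... | tri< _ _ _ | _         = there z∈
  ... | tri≈ _ _ _ | _         = z∈
  ... | tri> _ _ _ | here z≡y  = here z≡y
  ... | tri> _ _ _ | there z∈′ = there (∈-insert⁺ʳ ys z∈′)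

  insert-sorted : ∀ {x} ys → Sorted ys → Sorted (insert x ys)
  insert-sorted []             _ = [] ∷ []
  insert-sorted {x} (y ∷ ys) s@(y<ys ∷ sys) with <ˡ-cmp x y
  ... | tri< x<y _ _ = (x<y ∷ All.map (<ˡ-trans x<y) y<ys) ∷ s
  ... | tri≈ _ _ _   = s
  ... | tri> _ _ y<x = All.tabulate y<insert ∷ insert-sorted ys sys
    where
    y<insert : ∀ {w} → w ∈ insert x ys → y <ˡ w
    y<insert w∈ with ∈-insert⁻ ys w∈
    ... | inj₁ refl = y<x
    ... | inj₂ w∈ys = All.lookup y<ys w∈ys

  sort : List (Point n) → List (Point n)
  sort = L.foldr insert []

  sort-sorted : ∀ xs → Sorted (sort xs)
  sort-sorted []       = []
  sort-sorted (x ∷ xs) = insert-sorted (sort xs) (sort-sorted xs)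

  fromList : List (Point n) → FinSubset n
  fromList xs = mkFinSubset (sort xs) (LinkedP.AllPairs⇒Linked (sort-sorted xs))

  ∈-fromList⁻ : ∀ {z} xs → z ∈ elems (fromList xs) → z ∈ xs
  ∈-fromList⁻ (x ∷ xs) z∈ with ∈-insert⁻ (sort xs) z∈
  ... | inj₁ z≡x = here z≡x
  ... | inj₂ z∈′ = there (∈-fromList⁻ xs z∈′)

  ∈-fromList⁺ : ∀ {z} xs → z ∈ xs → z ∈ elems (fromList xs)
  ∈-fromList⁺ (x ∷ xs) (here refl) = ∈-insert⁺ˡ (sort xs)
  ∈-fromList⁺ (x ∷ xs) (there z∈)  = ∈-insert⁺ʳ (sort xs) (∈-fromList⁺ xs z∈)

  elems-sorted : (A : FinSubset n) → Sorted (elems A)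
  elems-sorted A = LinkedP.Linked⇒AllPairs <ˡ-trans (sorted A)

  elems-unique : (A : FinSubset n) → Unique (elems A)
  elems-unique A = AllPairs.map <ˡ⇒≢ (elems-sorted A)

  private
    ⊆-tail : ∀ {x : Point n} {xs ys} → All (x <ˡ_) xs → xs ⊆ x ∷ ys → xs ⊆ ys
    ⊆-tail x<xs xs⊆ z∈ with xs⊆ z∈
    ... | here refl = contradiction (All.lookup x<xs z∈) <ˡ-irrefl
    ... | there z∈′ = z∈′

    heads-≡ : ∀ {x y : Point n} {xs ys} → All (x <ˡ_) xs → All (y <ˡ_) ys → x ∈ y ∷ ys → y ∈ x ∷ xs → x ≡ y
    heads-≡ _    _    (here x≡y) _          = x≡y
    heads-≡ _    _    (there _)  (here y≡x) = sym y≡x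
    heads-≡ x<xs y<ys (there x∈) (there y∈) = contradiction (All.lookup y<ys x∈) (<ˡ-asym (All.lookup x<xs y∈))

  sorted-≡ : ∀ {xs ys : List (Point n)} → Sorted xs → Sorted ys → xs ⊆ ys → ys ⊆ xs → xs ≡ ys
  sorted-≡ {[]}     {[]}     _ _ _ _ = refl
  sorted-≡ {[]}     {y ∷ _}  _ _ _ ys⊆ = case ys⊆ (here refl) of λ ()
  sorted-≡ {x ∷ _}  {[]}     _ _ xs⊆ _ = case xs⊆ (here refl) of λ ()
  sorted-≡ {x ∷ xs} {y ∷ ys} (x<xs ∷ sxs) (y<ys ∷ sys) xs⊆ ys⊆
    with refl ← heads-≡ x<xs y<ys (xs⊆ (here refl)) (ys⊆ (here refl)) =
    cong (x ∷_) (sorted-≡ sxs sys (⊆-tail x<xs (xs⊆ ∘ there)) (⊆-tail y<ys (ys⊆ ∘ there)))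

  FinSubset-ext : (A B : FinSubset n) → elems A ⊆ elems B → elems B ⊆ elems A → A ≡ B
  FinSubset-ext A B A⊆B B⊆A = elems-injective A B (sorted-≡ (elems-sorted A) (elems-sorted B) A⊆B B⊆A)
    where
    elems-injective : (A B : FinSubset n) → elems A ≡ elems B → A ≡ B
    elems-injective (mkFinSubset xs p) (mkFinSubset .xs q) refl = cong (mkFinSubset xs) (Linked-irrelevant p q)

  card-≡ : (A : FinSubset n) {xs : List (Point n)} → Unique xs → elems A ⊆ xs → xs ⊆ elems A → card A ≡ length xs
  card-≡ A = length-cong-⊆ (elems-unique A)

-- Configurations and their used coordinates

origin : {n : ℕ} → Point n
origin {n} = replicate n 0

unit : {n : ℕ} → Fin n → Point n
unit fz     = 1 ∷ origin
unit (fs i) = 0 ∷ unit i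

_≟ᵖ_ : {n : ℕ} (x y : Point n) → Dec (x ≡ y)
_≟ᵖ_ = VP.≡-dec ℕ._≟_

origin-≤ᶜ : {n : ℕ} (x : Point n) → origin ≤ᶜ x
origin-≤ᶜ []      = []
origin-≤ᶜ (_ ∷ x) = z≤n ∷ origin-≤ᶜ x

lookup-mono-≤ᶜ : {n : ℕ} {x y : Point n} → x ≤ᶜ y → (i : Fin n) → lookup x i ≤ lookup y i
lookup-mono-≤ᶜ (a≤b ∷ _)  fz     = a≤b
lookup-mono-≤ᶜ (_ ∷ x≤y) (fs i) = lookup-mono-≤ᶜ x≤y i

degree-mono-≤ᶜ : {n : ℕ} {x y : Point n} → x ≤ᶜ y → degree x ≤ degree y
degree-mono-≤ᶜ []          = z≤n
degree-mono-≤ᶜ (a≤b ∷ x≤y) = +-mono-≤ a≤b (degree-mono-≤ᶜ x≤y)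

lookup≤degree : {n : ℕ} (x : Point n) (i : Fin n) → lookup x i ≤ degree x
lookup≤degree (a ∷ x) fz     = m≤m+n a (degree x)
lookup≤degree (a ∷ x) (fs i) = ≤-trans (lookup≤degree x i) (m≤n+m (degree x) a)

degree-origin : {n : ℕ} → degree (origin {n}) ≡ 0
degree-origin {zero}  = refl
degree-origin {suc n} = degree-origin {n}

degree≡0⇒origin : {n : ℕ} (x : Point n) → degree x ≡ 0 → x ≡ origin
degree≡0⇒origin []           _  = refl
degree≡0⇒origin (zero ∷ x) d≡0 = cong (0 ∷_) (degree≡0⇒origin x d≡0)

degree-unit : {n : ℕ} (i : Fin n) → degree (unit i) ≡ 1
degree-unit {suc n} fz = cong suc (degree-origin {n})
degree-unit (fs i)     = degree-unit i

lookup-origin : {n : ℕ} (i : Fin n) → lookup (origin {n}) i ≡ 0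
lookup-origin fz     = refl
lookup-origin (fs i) = lookup-origin i

lookup-unit : {n : ℕ} (i : Fin n) → lookup (unit i) i ≡ 1
lookup-unit fz     = refl
lookup-unit (fs i) = lookup-unit i

lookup-unit-≢ : {n : ℕ} {i j : Fin n} → i ≢ j → lookup (unit i) j ≡ 0
lookup-unit-≢ {i = fz}   {fz}   i≢j = contradiction refl i≢j
lookup-unit-≢ {i = fz}   {fs j} _   = lookup-origin j
lookup-unit-≢ {i = fs i} {fz}   _   = refl
lookup-unit-≢ {i = fs i} {fs j} i≢j = lookup-unit-≢ (i≢j ∘ cong fs)

unit-injective : {n : ℕ} {i j : Fin n} → unit i ≡ unit j → i ≡ j
unit-injective {i = i} {j} eq with i F.≟ j
... | yes i≡j = i≡j
... | no  i≢j = contradiction (trans (sym (lookup-unit i)) (trans (cong (λ x → lookup x i) eq) (lookup-unit-≢ (i≢j ∘ sym)))) λ ()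

unit≢origin : {n : ℕ} (i : Fin n) → unit i ≢ origin
unit≢origin {n} i eq = contradiction (trans (sym (degree-unit i)) (trans (cong degree eq) (degree-origin {n}))) λ ()

unit-≤ᶜ : {n : ℕ} (x : Point n) (i : Fin n) → 0 < lookup x i → unit i ≤ᶜ x
unit-≤ᶜ (_ ∷ x) fz     xᵢ>0 = xᵢ>0 ∷ origin-≤ᶜ x
unit-≤ᶜ (_ ∷ x) (fs i) xᵢ>0 = z≤n ∷ unit-≤ᶜ x i xᵢ>0

degree>0⇒lookup>0 : {n : ℕ} (x : Point n) → 0 < degree x → ∃ λ i → 0 < lookup x i
degree>0⇒lookup>0 (zero  ∷ x) d>0 = let (i , xᵢ>0) = degree>0⇒lookup>0 x d>0 in fs i , xᵢ>0
degree>0⇒lookup>0 (suc _ ∷ x) _   = fz , s≤s z≤n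

degree≤1⇒unit : {n : ℕ} (x : Point n) (j : Fin n) → degree x ≤ 1 → 0 < lookup x j → x ≡ unit j
degree≤1⇒unit (1 ∷ x)           fz     d≤1 _ = cong (1 ∷_) (degree≡0⇒origin x (n≤0⇒n≡0 (≤-pred d≤1)))
degree≤1⇒unit (suc (suc _) ∷ _) fz     (s≤s ()) _
degree≤1⇒unit (zero ∷ x)        (fs j) d≤1 xⱼ>0 = cong (0 ∷_) (degree≤1⇒unit x j d≤1 xⱼ>0)
degree≤1⇒unit (suc a ∷ x)       (fs j) (s≤s d≤0) xⱼ>0 =
  contradiction (≤-trans xⱼ>0 (≤-trans (lookup≤degree x j) (≤-trans (m≤n+m (degree x) a) d≤0))) λ ()

degree≡1⇒unit : {n : ℕ} (x : Point n) → degree x ≡ 1 → ∃ λ i → x ≡ unit i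
degree≡1⇒unit x d≡1 =
  let (i , xᵢ>0) = degree>0⇒lookup>0 x (≤-reflexive (sym d≡1)) in i , degree≤1⇒unit x i (≤-reflexive d≡1) xᵢ>0

≤ᶜ-unit : {n : ℕ} {x : Point n} (j : Fin n) → x ≤ᶜ unit j → x ≡ origin ⊎ x ≡ unit j
≤ᶜ-unit {x = x} j x≤uⱼ with degree x ℕ.≟ 0
... | yes d≡0 = inj₁ (degree≡0⇒origin x d≡0)
... | no  d≢0 with i , xᵢ>0 ← degree>0⇒lookup>0 x (n≢0⇒n>0 d≢0) with i F.≟ j
...   | yes refl = inj₂ (degree≤1⇒unit x j (≤-trans (degree-mono-≤ᶜ x≤uⱼ) (≤-reflexive (degree-unit j))) xᵢ>0)
...   | no  i≢j  = contradiction (≤-trans xᵢ>0 (≤-trans (lookup-mono-≤ᶜ x≤uⱼ i) (≤-reflexive (lookup-unit-≢ (i≢j ∘ sym))))) λ ()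

extras : {n : ℕ} → FinSubset n → List (Point n)
extras A = filter (λ x → 2 ≤? degree x) (elems A)

#extras : {n : ℕ} → FinSubset n → ℕ
#extras A = length (extras A)

record Config (e : ℕ) {n : ℕ} (A : FinSubset n) : Set where
  field
    downClosed : DownClosed A
    origin∈    : origin ∈ elems A
    unit∈      : ∀ i → unit i ∈ elems A
    #extras≡   : #extras A ≡ e

length-by-degree : {n : ℕ} (xs : List (Point n)) →
  length xs ≡ length (filter (λ x → degree x ℕ.≟ 0) xs)
            + (length (filter (λ x → degree x ℕ.≟ 1) xs) + length (filter (λ x → 2 ≤? degree x) xs))
length-by-degree []       = refl
length-by-degree (x ∷ xs) with degree x | length-by-degree xs
... | 0           | ih = cong suc ih
... | 1           | ih = trans (cong suc ih) (sym (+-suc _ _))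
... | suc (suc _) | ih = trans (cong suc ih) (sym (trans (cong (λ k → d₀ + k) (+-suc d₁ d₂)) (+-suc d₀ (d₁ + d₂))))
  where
  d₀ = length (filter (λ x → degree x ℕ.≟ 0) xs)
  d₁ = length (filter (λ x → degree x ℕ.≟ 1) xs)
  d₂ = length (filter (λ x → 2 ≤? degree x) xs)

card-by-degree : {n : ℕ} (A : FinSubset n) → card A ≡ h A 0 + (h A 1 + #extras A)
card-by-degree A = length-by-degree (elems A)

h-zero : {n : ℕ} (A : FinSubset n) → origin ∈ elems A → h A 0 ≡ 1
h-zero {n} A o∈A = length-filter-≡ (λ x → degree x ℕ.≟ 0) (elems-unique A) ([] ∷ [])
  (λ {x} _ d≡0 → here (degree≡0⇒origin x d≡0))
  (λ { (here refl) → o∈A , degree-origin {n} })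

units : (n : ℕ) → List (Point n)
units n = map unit (L.allFin n)

units-unique : (n : ℕ) → Unique (units n)
units-unique n = UP.map⁺ unit-injective (UP.allFin⁺ n)

length-units : (n : ℕ) → length (units n) ≡ n
length-units n = trans (LP.length-map unit (L.allFin n)) (LP.length-tabulate id)

unit∈units : {n : ℕ} (i : Fin n) → unit i ∈ units n
unit∈units i = MP.∈-map⁺ unit (MP.∈-allFin i)

degree-one⊆units : {n : ℕ} (A : FinSubset n) → filter (λ x → degree x ℕ.≟ 1) (elems A) ⊆ units n
degree-one⊆units A {x} x∈ with degree≡1⇒unit x (proj₂ (MP.∈-filter⁻ (λ x → degree x ℕ.≟ 1) {xs = elems A} x∈))
... | (i , refl) = unit∈units i

h-one≡n⇒unit∈ : {n : ℕ} (A : FinSubset n) → h A 1 ≡ n → ∀ i → unit i ∈ elems A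
h-one≡n⇒unit∈ {n} A h≡n i = proj₁ (MP.∈-filter⁻ (λ x → degree x ℕ.≟ 1) {xs = elems A}
  (⊆-length⇒⊇ _≟ᵖ_ (UP.filter⁺ _ (elems-unique A)) (degree-one⊆units A)
    (≤-reflexive (trans (length-units n) (sym h≡n))) (unit∈units i)))

unit∈⇒h-one≡n : {n : ℕ} (A : FinSubset n) → (∀ i → unit i ∈ elems A) → h A 1 ≡ n
unit∈⇒h-one≡n {n} A unit∈ = trans
  (length-filter-≡ (λ x → degree x ℕ.≟ 1) (elems-unique A) (units-unique n)
    (λ x∈A d≡1 → degree-one⊆units A (MP.∈-filter⁺ (λ x → degree x ℕ.≟ 1) {xs = elems A} x∈A d≡1))
    (λ u∈ → let (i , _ , u≡) = MP.∈-map⁻ unit u∈ in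
            subst (λ u → u ∈ elems A × degree u ≡ 1) (sym u≡) (unit∈ i , degree-unit i)))
  (length-units n)

DownClosed⇒origin∈ : {n : ℕ} (A : FinSubset n) → DownClosed A → 0 < card A → origin ∈ elems A
DownClosed⇒origin∈ (mkFinSubset (x ∷ _) _) down _ = down x origin (here refl) (origin-≤ᶜ x)

Config⇒IsY-member : {e n : ℕ} {A : FinSubset n} → Config e A → InP n (suc (n + e)) A × h A 1 ≡ n
Config⇒IsY-member {A = A} c = (downClosed , card≡) , unit∈⇒h-one≡n A unit∈
  where
  open Config c
  card≡ = trans (card-by-degree A) (cong₂ _+_ (h-zero A origin∈) (cong₂ _+_ (unit∈⇒h-one≡n A unit∈) #extras≡))

IsY-member⇒Config : {e n : ℕ} {A : FinSubset n} → InP n (suc (n + e)) A × h A 1 ≡ n → Config e A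
IsY-member⇒Config {e} {n} {A} ((down , card≡) , h≡n) = record
  { downClosed = down
  ; origin∈    = o∈A
  ; unit∈      = h-one≡n⇒unit∈ A h≡n
  ; #extras≡   = +-cancelˡ-≡ n _ _ (suc-injective (trans (sym card≡′) card≡))
  }
  where
  o∈A = DownClosed⇒origin∈ A down (subst (0 <_) (sym card≡) (s≤s z≤n))
  card≡′ : card A ≡ suc (n + #extras A)
  card≡′ = trans (card-by-degree A) (cong₂ _+_ (h-zero A o∈A) (cong (_+ #extras A) h≡n))

IsY⇒HasCount-Config : {e n m : ℕ} → IsY n (suc (n + e)) m → HasCount (Config e {n}) m
IsY⇒HasCount-Config = HasCount-resp IsY-member⇒Config Config⇒IsY-member

Uses : {n : ℕ} → FinSubset n → Fin n → Set
Uses A i = ∃ λ x → x ∈ elems A × 0 < lookup x i × 2 ≤ degree x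

Uses? : {n : ℕ} (A : FinSubset n) (i : Fin n) → Dec (Uses A i)
Uses? A i = map′ (λ any → let (x , x∈ , p) = find any in x , x∈ , p) (λ (_ , x∈ , p) → lose x∈ p)
  (Any.any? (λ x → (0 <? lookup x i) ×-dec (2 ≤? degree x)) (elems A))

data Mode : Set where
  required forbidden free : Mode

⟦_⟧ : Mode → Set → Set
⟦ required  ⟧ P = P
⟦ forbidden ⟧ P = ¬ P
⟦ free      ⟧ P = ⊤

⟦_⟧? : (m : Mode) {P : Set} → Dec P → Dec (⟦ m ⟧ P)
⟦ required  ⟧? P? = P?
⟦ forbidden ⟧? P? = ¬? P?
⟦ free      ⟧? _  = yes tt

⟦_⟧-map : (m : Mode) {P Q : Set} → (P → Q) → (Q → P) → ⟦ m ⟧ P → ⟦ m ⟧ Q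
⟦ required  ⟧-map to _    p  = to p
⟦ forbidden ⟧-map _  from ¬p = ¬p ∘ from
⟦ free      ⟧-map _  _    _  = tt

Pattern : ℕ → Set
Pattern n = Fin n → Mode

Obeys : {n : ℕ} → Pattern n → FinSubset n → Set
Obeys π A = ∀ i → ⟦ π i ⟧ (Uses A i)

Obeys? : {n : ℕ} (π : Pattern n) → Decidable (Obeys π)
Obeys? π A = FP.all? (λ i → ⟦ π i ⟧? (Uses? A i))

ConfigOn : ℕ → {n : ℕ} → Pattern n → FinSubset n → Set
ConfigOn e π A = Config e A × Obeys π A

module _ {n : ℕ} {π : Pattern n} {A : FinSubset n} where

  Obeys-at : ∀ {j m} → π j ≡ m → Obeys π A → ⟦ m ⟧ (Uses A j)
  Obeys-at {j} πj≡m obeys = subst (λ m → ⟦ m ⟧ (Uses A j)) πj≡m (obeys j)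

  Obeys-update : (j : Fin n) {π′ : Pattern n} → (∀ i → i ≢ j → π′ i ≡ π i) → Obeys π A →
    ⟦ π′ j ⟧ (Uses A j) → Obeys π′ A
  Obeys-update j agree obeys at-j i with i F.≟ j
  ... | yes refl = at-j
  ... | no  i≢j  = subst (λ m → ⟦ m ⟧ (Uses A i)) (sym (agree i i≢j)) (obeys i)

  Obeys-cong : {π′ : Pattern n} → (∀ i → π i ≡ π′ i) → Obeys π A → Obeys π′ A
  Obeys-cong π≗π′ obeys i = subst (λ m → ⟦ m ⟧ (Uses A i)) (π≗π′ i) (obeys i)

allRequired : {n : ℕ} → Pattern n
allRequired _ = required

_[_]≔_ : {n : ℕ} → Pattern n → Fin n → Mode → Pattern n
(π [ j ]≔ m) i with i F.≟ j
... | yes _ = m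
... | no  _ = π i

[]≔-updated : {n : ℕ} (π : Pattern n) (j : Fin n) (m : Mode) → (π [ j ]≔ m) j ≡ m
[]≔-updated π j m with j F.≟ j
... | yes _   = refl
... | no  j≢j = contradiction refl j≢j

[]≔-other : {n : ℕ} (π : Pattern n) {i j : Fin n} (m : Mode) → i ≢ j → (π [ j ]≔ m) i ≡ π i
[]≔-other π {i} {j} m i≢j with i F.≟ j
... | yes i≡j = contradiction i≡j i≢j
... | no  _   = refl

prefix : {n : ℕ} → ℕ → Pattern n
prefix b i with F.toℕ i <? b
... | yes _ = required
... | no  _ = free

prefix-< : {n : ℕ} {b : ℕ} {i : Fin n} → F.toℕ i < b → prefix b i ≡ required
prefix-< {b = b} {i} i<b with F.toℕ i <? b
... | yes _   = refl
... | no  i≮b = contradiction i<b i≮b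

prefix-≥ : {n : ℕ} {b : ℕ} {i : Fin n} → b ≤ F.toℕ i → prefix b i ≡ free
prefix-≥ {b = b} {i} b≤i with F.toℕ i <? b
... | yes i<b = contradiction b≤i (<⇒≱ i<b)
... | no  _   = refl

toℕ-punchIn-< : {n : ℕ} (j : Fin (suc n)) (i : Fin n) → F.toℕ i < F.toℕ j → F.toℕ (punchIn j i) ≡ F.toℕ i
toℕ-punchIn-< (fs j) fz     _         = refl
toℕ-punchIn-< (fs j) (fs i) (s≤s i<j) = cong suc (toℕ-punchIn-< j i i<j)

toℕ-punchIn-≥ : {n : ℕ} (j : Fin (suc n)) (i : Fin n) → F.toℕ j ≤ F.toℕ i → F.toℕ (punchIn j i) ≡ suc (F.toℕ i)
toℕ-punchIn-≥ fz     i      _         = refl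
toℕ-punchIn-≥ (fs j) (fs i) (s≤s j≤i) = cong suc (toℕ-punchIn-≥ j i j≤i)

prefix-punchIn : {n : ℕ} (j : Fin (suc n)) (i : Fin n) → prefix (F.toℕ j) (punchIn j i) ≡ prefix (F.toℕ j) i
prefix-punchIn j i with F.toℕ i <? F.toℕ j
... | yes i<j = prefix-< (subst (_< F.toℕ j) (sym (toℕ-punchIn-< j i i<j)) i<j)
... | no  i≮j = prefix-≥ (subst (F.toℕ j ≤_) (sym (toℕ-punchIn-≥ j i (≮⇒≥ i≮j))) (m≤n⇒m≤1+n (≮⇒≥ i≮j)))

prefix-suc : {n : ℕ} {b : ℕ} {i : Fin n} → F.toℕ i ≢ b → prefix (suc b) i ≡ prefix b i
prefix-suc {b = b} {i} i≢b with <-cmp (F.toℕ i) b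
... | tri< i<b _ _ = trans (prefix-< (m<n⇒m<1+n i<b)) (sym (prefix-< i<b))
... | tri≈ _ i≡b _ = contradiction i≡b i≢b
... | tri> _ _ i>b = trans (prefix-≥ i>b) (sym (prefix-≥ (<⇒≤ i>b)))

-- Deleting an unused coordinate

data PunchView {n : ℕ} (j : Fin (suc n)) : Fin (suc n) → Set where
  at  : PunchView j j
  off : (i : Fin n) → PunchView j (punchIn j i)

punchView : {n : ℕ} (j i : Fin (suc n)) → PunchView j i
punchView j i with j F.≟ i
... | yes refl = at
... | no  j≢i  = subst (PunchView j) (FP.punchIn-punchOut j≢i) (off (punchOut j≢i))

degree-insertAt-0 : {n : ℕ} (v : Point n) (j : Fin (suc n)) → degree (insertAt v j 0) ≡ degree v
degree-insertAt-0 v       fz     = refl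
degree-insertAt-0 (a ∷ v) (fs j) = cong (λ d → a + d) (degree-insertAt-0 v j)

insertAt-mono-≤ᶜ : {n : ℕ} {v w : Point n} (j : Fin (suc n)) → v ≤ᶜ w → insertAt v j 0 ≤ᶜ insertAt w j 0
insertAt-mono-≤ᶜ fz     v≤w         = z≤n ∷ v≤w
insertAt-mono-≤ᶜ (fs j) (a≤b ∷ v≤w) = a≤b ∷ insertAt-mono-≤ᶜ j v≤w

removeAt-mono-≤ᶜ : {n : ℕ} {x y : Point (suc n)} (j : Fin (suc n)) → x ≤ᶜ y → removeAt x j ≤ᶜ removeAt y j
removeAt-mono-≤ᶜ fz             (_ ∷ x≤y)   = x≤y
removeAt-mono-≤ᶜ {suc n} (fs j) (a≤b ∷ x≤y@(_ ∷ _)) = a≤b ∷ removeAt-mono-≤ᶜ j x≤y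

insertAt-origin : {n : ℕ} (j : Fin (suc n)) → insertAt (origin {n}) j 0 ≡ origin
insertAt-origin fz             = refl
insertAt-origin {suc n} (fs j) = cong (0 ∷_) (insertAt-origin j)

insertAt-unit : {n : ℕ} (j : Fin (suc n)) (i : Fin n) → insertAt (unit i) j 0 ≡ unit (punchIn j i)
insertAt-unit fz             i      = refl
insertAt-unit {suc n} (fs j) fz     = cong (1 ∷_) (insertAt-origin j)
insertAt-unit {suc n} (fs j) (fs i) = cong (0 ∷_) (insertAt-unit j i)

-- A configuration not using coordinate j comes from one in dimension one less: embed that in the
-- hyperplane xⱼ = 0 and add eⱼ.
module Widening {n : ℕ} (j : Fin (suc n)) where

  embed : Point n → Point (suc n)
  embed v = insertAt v j 0

  lookup-embed : (v : Point n) → lookup (embed v) j ≡ 0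
  lookup-embed v = VP.insertAt-lookup v j 0

  embed-removeAt : (x : Point (suc n)) → lookup x j ≡ 0 → embed (removeAt x j) ≡ x
  embed-removeAt x xⱼ≡0 = trans (cong (insertAt (removeAt x j) j) (sym xⱼ≡0)) (VP.insertAt-removeAt x j)

  embed-injective : {v w : Point n} → embed v ≡ embed w → v ≡ w
  embed-injective {v} {w} eq =
    trans (sym (VP.removeAt-insertAt v j 0)) (trans (cong (λ x → removeAt x j) eq) (VP.removeAt-insertAt w j 0))

  unit≢embed : (v : Point n) → unit j ≢ embed v
  unit≢embed v eq = contradiction (trans (sym (lookup-unit j)) (trans (cong (λ x → lookup x j) eq) (lookup-embed v))) λ ()

  widen : FinSubset n → FinSubset (suc n)
  widen μ = fromList (unit j ∷ map embed (elems μ))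

  narrow : FinSubset (suc n) → FinSubset n
  narrow A = fromList (map (λ x → removeAt x j) (filter (λ x → lookup x j ℕ.≟ 0) (elems A)))

  ∈-widen⁻ : ∀ {μ x} → x ∈ elems (widen μ) → x ≡ unit j ⊎ ∃ λ v → v ∈ elems μ × x ≡ embed v
  ∈-widen⁻ {μ} x∈ with ∈-fromList⁻ (unit j ∷ map embed (elems μ)) x∈
  ... | here x≡uⱼ = inj₁ x≡uⱼ
  ... | there x∈′ = inj₂ (MP.∈-map⁻ embed x∈′)

  unit∈widen : ∀ μ → unit j ∈ elems (widen μ)
  unit∈widen μ = ∈-fromList⁺ (unit j ∷ map embed (elems μ)) (here refl)

  embed∈widen⁺ : ∀ μ {v} → v ∈ elems μ → embed v ∈ elems (widen μ)
  embed∈widen⁺ μ v∈ = ∈-fromList⁺ (unit j ∷ map embed (elems μ)) (there (MP.∈-map⁺ embed v∈))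

  embed∈widen⁻ : ∀ μ {v} → embed v ∈ elems (widen μ) → v ∈ elems μ
  embed∈widen⁻ μ x∈ with ∈-widen⁻ {μ} x∈
  ... | inj₁ eq             = contradiction (sym eq) (unit≢embed _)
  ... | inj₂ (w , w∈ , eq) = subst (_∈ elems μ) (sym (embed-injective eq)) w∈

  ∈-narrow⁻ : ∀ A {v} → v ∈ elems (narrow A) → embed v ∈ elems A
  ∈-narrow⁻ A v∈ with MP.∈-map⁻ (λ x → removeAt x j) (∈-fromList⁻ _ v∈)
  ... | (x , x∈ , refl) = let (x∈A , xⱼ≡0) = MP.∈-filter⁻ (λ x → lookup x j ℕ.≟ 0) {xs = elems A} x∈ in
                          subst (_∈ elems A) (sym (embed-removeAt x xⱼ≡0)) x∈A

  ∈-narrow⁺ : ∀ A {v} → embed v ∈ elems A → v ∈ elems (narrow A)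
  ∈-narrow⁺ A {v} x∈ = ∈-fromList⁺ _ (subst (_∈ map (λ x → removeAt x j) _) (VP.removeAt-insertAt v j 0)
    (MP.∈-map⁺ (λ x → removeAt x j) (MP.∈-filter⁺ (λ x → lookup x j ℕ.≟ 0) x∈ (lookup-embed v))))

  narrow-widen : ∀ μ → narrow (widen μ) ≡ μ
  narrow-widen μ = FinSubset-ext _ μ (embed∈widen⁻ μ ∘ ∈-narrow⁻ (widen μ)) (∈-narrow⁺ (widen μ) ∘ embed∈widen⁺ μ)

  #extras-widen : ∀ μ → #extras (widen μ) ≡ #extras μ
  #extras-widen μ = trans
    (length-filter-≡ (λ x → 2 ≤? degree x) (elems-unique (widen μ)) (UP.map⁺ embed-injective (UP.filter⁺ _ (elems-unique μ))) to from)
    (LP.length-map embed (extras μ))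
    where
    to : ∀ {x} → x ∈ elems (widen μ) → 2 ≤ degree x → x ∈ map embed (extras μ)
    to x∈ d≥2 with ∈-widen⁻ {μ} x∈
    ... | inj₁ refl = contradiction (subst (2 ≤_) (degree-unit j) d≥2) λ { (s≤s ()) }
    ... | inj₂ (v , v∈ , refl) = MP.∈-map⁺ embed (MP.∈-filter⁺ (λ x → 2 ≤? degree x) v∈ (subst (2 ≤_) (degree-insertAt-0 v j) d≥2))
    from : ∀ {x} → x ∈ map embed (extras μ) → x ∈ elems (widen μ) × 2 ≤ degree x
    from x∈ with MP.∈-map⁻ embed x∈
    ... | (v , v∈ , refl) = let (v∈μ , d≥2) = MP.∈-filter⁻ (λ x → 2 ≤? degree x) {xs = elems μ} v∈ in
                            embed∈widen⁺ μ v∈μ , subst (2 ≤_) (sym (degree-insertAt-0 v j)) d≥2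

  widen-downClosed : ∀ μ → origin ∈ elems μ → DownClosed μ → DownClosed (widen μ)
  widen-downClosed μ o∈μ down x y x∈ y≤x with ∈-widen⁻ {μ} x∈
  ... | inj₁ refl with ≤ᶜ-unit j y≤x
  ...   | inj₁ refl = subst (_∈ elems (widen μ)) (insertAt-origin j) (embed∈widen⁺ μ o∈μ)
  ...   | inj₂ refl = unit∈widen μ
  widen-downClosed μ o∈μ down x y x∈ y≤x | inj₂ (v , v∈ , refl) =
    subst (_∈ elems (widen μ)) (embed-removeAt y yⱼ≡0)
      (embed∈widen⁺ μ (down v (removeAt y j) v∈ (subst (removeAt y j ≤ᶜ_) (VP.removeAt-insertAt v j 0) (removeAt-mono-≤ᶜ j y≤x))))
    where
    yⱼ≡0 = n≤0⇒n≡0 (≤-trans (lookup-mono-≤ᶜ y≤x j) (≤-reflexive (lookup-embed v)))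

  Config-widen⁺ : ∀ {e} μ → Config e μ → Config e (widen μ)
  Config-widen⁺ μ c = record
    { downClosed = widen-downClosed μ origin∈ downClosed
    ; origin∈    = subst (_∈ elems (widen μ)) (insertAt-origin j) (embed∈widen⁺ μ origin∈)
    ; unit∈      = λ i → unit∈′ i (punchView j i)
    ; #extras≡   = trans (#extras-widen μ) #extras≡
    }
    where
    open Config c
    unit∈′ : ∀ i → PunchView j i → unit i ∈ elems (widen μ)
    unit∈′ _ at      = unit∈widen μ
    unit∈′ _ (off i) = subst (_∈ elems (widen μ)) (insertAt-unit j i) (embed∈widen⁺ μ (unit∈ i))

  Config-widen⁻ : ∀ {e} μ → Config e (widen μ) → Config e μ
  Config-widen⁻ μ c = record
    { downClosed = λ x y x∈ y≤x → embed∈widen⁻ μ (downClosed (embed x) (embed y) (embed∈widen⁺ μ x∈) (insertAt-mono-≤ᶜ j y≤x))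
    ; origin∈    = embed∈widen⁻ μ (subst (_∈ elems (widen μ)) (sym (insertAt-origin j)) origin∈)
    ; unit∈      = λ i → embed∈widen⁻ μ (subst (_∈ elems (widen μ)) (sym (insertAt-unit j i)) (unit∈ (punchIn j i)))
    ; #extras≡   = trans (sym (#extras-widen μ)) #extras≡
    }
    where open Config c

  ¬Uses-widen : ∀ μ → ¬ Uses (widen μ) j
  ¬Uses-widen μ (x , x∈ , xⱼ>0 , d≥2) with ∈-widen⁻ {μ} x∈
  ... | inj₁ refl            = contradiction (subst (2 ≤_) (degree-unit j) d≥2) λ { (s≤s ()) }
  ... | inj₂ (v , _ , refl) = contradiction (subst (0 <_) (lookup-embed v) xⱼ>0) λ ()

  Uses-widen⁺ : ∀ μ {i} → Uses μ i → Uses (widen μ) (punchIn j i)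
  Uses-widen⁺ μ {i} (v , v∈ , vᵢ>0 , d≥2) = embed v , embed∈widen⁺ μ v∈ ,
    subst (0 <_) (sym (VP.insertAt-punchIn v j 0 i)) vᵢ>0 , subst (2 ≤_) (sym (degree-insertAt-0 v j)) d≥2

  Uses-widen⁻ : ∀ μ {i} → Uses (widen μ) (punchIn j i) → Uses μ i
  Uses-widen⁻ μ {i} (x , x∈ , xᵢ>0 , d≥2) with ∈-widen⁻ {μ} x∈
  ... | inj₁ refl            = contradiction (subst (2 ≤_) (degree-unit j) d≥2) λ { (s≤s ()) }
  ... | inj₂ (v , v∈ , refl) = v , v∈ , subst (0 <_) (VP.insertAt-punchIn v j 0 i) xᵢ>0 , subst (2 ≤_) (degree-insertAt-0 v j) d≥2

  Obeys-widen⁺ : ∀ {π : Pattern (suc n)} μ → π j ≡ forbidden → Obeys (π ∘ punchIn j) μ → Obeys π (widen μ)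
  Obeys-widen⁺ {π} μ πⱼ≡forbidden obeys i = go (punchView j i)
    where
    go : ∀ {i} → PunchView j i → ⟦ π i ⟧ (Uses (widen μ) i)
    go at      = subst (λ m → ⟦ m ⟧ (Uses (widen μ) j)) (sym πⱼ≡forbidden) (¬Uses-widen μ)
    go (off i) = ⟦ π (punchIn j i) ⟧-map (Uses-widen⁺ μ) (Uses-widen⁻ μ) (obeys i)

  Obeys-widen⁻ : ∀ {π : Pattern (suc n)} μ → Obeys π (widen μ) → Obeys (π ∘ punchIn j) μ
  Obeys-widen⁻ {π} μ obeys i = ⟦ π (punchIn j i) ⟧-map (Uses-widen⁻ μ) (Uses-widen⁺ μ) (obeys (punchIn j i))

  widen-narrow : ∀ {e} A → Config e A → ¬ Uses A j → widen (narrow A) ≡ A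
  widen-narrow A c ¬uses = FinSubset-ext _ A ⊆A A⊆
    where
    open Config c
    ⊆A : elems (widen (narrow A)) ⊆ elems A
    ⊆A x∈ with ∈-widen⁻ {narrow A} x∈
    ... | inj₁ refl            = unit∈ j
    ... | inj₂ (v , v∈ , refl) = ∈-narrow⁻ A v∈
    A⊆ : elems A ⊆ elems (widen (narrow A))
    A⊆ {x} x∈ with lookup x j ℕ.≟ 0
    ... | yes xⱼ≡0 = subst (_∈ elems (widen (narrow A))) (embed-removeAt x xⱼ≡0)
                       (embed∈widen⁺ (narrow A) (∈-narrow⁺ A (subst (_∈ elems A) (sym (embed-removeAt x xⱼ≡0)) x∈)))
    ... | no  xⱼ≢0 with 2 ≤? degree x
    ...   | yes d≥2 = contradiction (x , x∈ , n≢0⇒n>0 xⱼ≢0 , d≥2) ¬uses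
    ...   | no  d≱2 = subst (_∈ elems (widen (narrow A))) (sym (degree≤1⇒unit x j (≤-pred (≰⇒> d≱2)) (n≢0⇒n>0 xⱼ≢0)))
                        (unit∈widen (narrow A))

HasCount-widen : {e n m : ℕ} {π : Pattern (suc n)} (j : Fin (suc n)) → π j ≡ forbidden →
  HasCount (ConfigOn e (π ∘ punchIn j)) m → HasCount (ConfigOn e π) m
HasCount-widen {e} {π = π} j πⱼ≡forbidden count = HasCount-bijection count widen narrow
  (λ {μ} _ → narrow-widen μ)
  (λ {μ} (c , obeys) → Config-widen⁺ μ c , Obeys-widen⁺ μ πⱼ≡forbidden obeys)
  complete
  where
  open Widening j
  complete : ∀ {A} → ConfigOn e π A → ConfigOn e (π ∘ punchIn j) (narrow A) × widen (narrow A) ≡ A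
  complete {A} (c , obeys) = (Config-widen⁻ (narrow A) (subst (Config e) (sym eq) c) ,
                              Obeys-widen⁻ (narrow A) (subst (Obeys π) (sym eq) obeys)) , eq
    where
    eq = widen-narrow A c (Obeys-at {π = π} {A} πⱼ≡forbidden obeys)

-- Slicing along the first coordinate

slice : {n : ℕ} → ℕ → FinSubset (suc n) → FinSubset n
slice a A = fromList (map V.tail (filter (λ x → V.head x ℕ.≟ a) (elems A)))

module _ {n : ℕ} where

  ∈-slice⁻ : ∀ {a} A {v : Point n} → v ∈ elems (slice a A) → (a ∷ v) ∈ elems A
  ∈-slice⁻ {a} A v∈ with MP.∈-map⁻ V.tail (∈-fromList⁻ _ v∈)
  ... | (b ∷ w , x∈ , refl) with MP.∈-filter⁻ (λ x → V.head x ℕ.≟ a) {xs = elems A} x∈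
  ...   | (x∈A , refl) = x∈A

  ∈-slice⁺ : ∀ {a} A {v : Point n} → (a ∷ v) ∈ elems A → v ∈ elems (slice a A)
  ∈-slice⁺ {a} A x∈ = ∈-fromList⁺ _ (MP.∈-map⁺ V.tail (MP.∈-filter⁺ (λ x → V.head x ℕ.≟ a) x∈ refl))

  slice-downClosed : ∀ a A → DownClosed A → DownClosed (slice a A)
  slice-downClosed a A down v w v∈ w≤v = ∈-slice⁺ A (down (a ∷ v) (a ∷ w) (∈-slice⁻ A v∈) (≤-refl ∷ w≤v))

  length-filter-slice : ∀ a A {P : Point n → Set} (P? : Decidable P) →
    length (filter (λ x → (V.head x ℕ.≟ a) ×-dec P? (V.tail x)) (elems A)) ≡ length (filter P? (elems (slice a A)))
  length-filter-slice a A {P} P? = trans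
    (length-filter-≡ _ (elems-unique A) (UP.map⁺ ∷-injectiveʳ (UP.filter⁺ P? (elems-unique (slice a A)))) to from)
    (LP.length-map (V._∷_ a) (filter P? (elems (slice a A))))
    where
    ∷-injectiveʳ : {v w : Point n} → (Point (suc n) ∋ a ∷ v) ≡ a ∷ w → v ≡ w
    ∷-injectiveʳ refl = refl
    to : ∀ {x} → x ∈ elems A → V.head x ≡ a × P (V.tail x) → x ∈ map (V._∷_ a) (filter P? (elems (slice a A)))
    to {_ ∷ v} x∈ (refl , pv) = MP.∈-map⁺ (V._∷_ a) (MP.∈-filter⁺ P? (∈-slice⁺ A x∈) pv)
    from : ∀ {x} → x ∈ map (V._∷_ a) (filter P? (elems (slice a A))) → x ∈ elems A × (V.head x ≡ a × P (V.tail x))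
    from x∈ with MP.∈-map⁻ (V._∷_ a) x∈
    ... | (v , v∈ , refl) = let (v∈′ , pv) = MP.∈-filter⁻ P? {xs = elems (slice a A)} v∈ in ∈-slice⁻ A v∈′ , refl , pv

nonzeros : {n : ℕ} → FinSubset n → List (Point n)
nonzeros A = filter (λ x → 1 ≤? degree x) (elems A)

#nonzeros : {n : ℕ} → FinSubset n → ℕ
#nonzeros A = length (nonzeros A)

#high : {n : ℕ} → FinSubset (suc n) → ℕ
#high A = length (filter (λ x → 2 ≤? V.head x) (elems A))

length-extras-by-head : {n : ℕ} (xs : List (Point (suc n))) →
  length (filter (λ x → 2 ≤? degree x) xs)
    ≡ length (filter (λ x → (V.head x ℕ.≟ 0) ×-dec (2 ≤? degree (V.tail x))) xs)
      + (length (filter (λ x → (V.head x ℕ.≟ 1) ×-dec (1 ≤? degree (V.tail x))) xs)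
         + length (filter (λ x → 2 ≤? V.head x) xs))
length-extras-by-head [] = refl
length-extras-by-head ((a ∷ v) ∷ xs) with a | degree v | length-extras-by-head xs
... | 0           | 0           | ih = ih
... | 0           | 1           | ih = ih
... | 0           | suc (suc _) | ih = cong suc ih
... | 1           | 0           | ih = ih
... | 1           | suc _       | ih = trans (cong suc ih) (sym (+-suc _ _))
... | suc (suc _) | _           | ih = trans (cong suc ih) (sym (trans (cong (λ k → h₀ + k) (+-suc h₁ h₂)) (+-suc h₀ (h₁ + h₂))))
  where
  h₀ = length (filter (λ x → (V.head x ℕ.≟ 0) ×-dec (2 ≤? degree (V.tail x))) xs)
  h₁ = length (filter (λ x → (V.head x ℕ.≟ 1) ×-dec (1 ≤? degree (V.tail x))) xs)
  h₂ = length (filter (λ x → 2 ≤? V.head x) xs)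

#extras-by-slices : {n : ℕ} (A : FinSubset (suc n)) → #extras A ≡ #extras (slice 0 A) + (#nonzeros (slice 1 A) + #high A)
#extras-by-slices A = trans (length-extras-by-head (elems A))
  (cong₂ _+_ (length-filter-slice 0 A (λ v → 2 ≤? degree v))
             (cong (_+ #high A) (length-filter-slice 1 A (λ v → 1 ≤? degree v))))

∅ : {n : ℕ} → FinSubset n
∅ = mkFinSubset [] []

∅-downClosed : {n : ℕ} → DownClosed (∅ {n})
∅-downClosed _ _ ()

∈-map-∷⁻ : {n : ℕ} {a c : ℕ} {v : Point n} {xs : List (Point n)} → (a ∷ v) ∈ map (V._∷_ c) xs → a ≡ c × v ∈ xs
∈-map-∷⁻ {c = c} x∈ with MP.∈-map⁻ (V._∷_ c) x∈
... | (_ , v∈ , refl) = refl , v∈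

module _ {n : ℕ} (A B K : FinSubset n) where

  layer : ℕ → FinSubset n
  layer 0 = A
  layer 1 = B
  layer 2 = K
  layer (suc (suc (suc _))) = ∅

  join : FinSubset (suc n)
  join = fromList (map (V._∷_ 0) (elems A) ++ map (V._∷_ 1) (elems B) ++ map (V._∷_ 2) (elems K))

  ∈-join⁻ : ∀ {a v} → (a ∷ v) ∈ elems join → v ∈ elems (layer a)
  ∈-join⁻ x∈ with MP.∈-++⁻ (map (V._∷_ 0) (elems A)) (∈-fromList⁻ _ x∈)
  ... | inj₁ x∈A with refl , v∈ ← ∈-map-∷⁻ x∈A = v∈
  ... | inj₂ x∈BK with MP.∈-++⁻ (map (V._∷_ 1) (elems B)) x∈BK
  ...   | inj₁ x∈B with refl , v∈ ← ∈-map-∷⁻ x∈B = v∈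
  ...   | inj₂ x∈K with refl , v∈ ← ∈-map-∷⁻ x∈K = v∈

  ∈-join⁺ : ∀ a {v} → v ∈ elems (layer a) → (a ∷ v) ∈ elems join
  ∈-join⁺ 0 v∈ = ∈-fromList⁺ _ (MP.∈-++⁺ˡ (MP.∈-map⁺ (V._∷_ 0) v∈))
  ∈-join⁺ 1 v∈ = ∈-fromList⁺ _ (MP.∈-++⁺ʳ (map (V._∷_ 0) (elems A)) (MP.∈-++⁺ˡ (MP.∈-map⁺ (V._∷_ 1) v∈)))
  ∈-join⁺ 2 v∈ = ∈-fromList⁺ _ (MP.∈-++⁺ʳ (map (V._∷_ 0) (elems A)) (MP.∈-++⁺ʳ (map (V._∷_ 1) (elems B)) (MP.∈-map⁺ (V._∷_ 2) v∈)))
  ∈-join⁺ (suc (suc (suc _))) ()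

  slice-join : ∀ a → slice a join ≡ layer a
  slice-join a = FinSubset-ext _ _ (∈-join⁻ ∘ ∈-slice⁻ join) (∈-slice⁺ join ∘ ∈-join⁺ a)

  #high-join : #high join ≡ card K
  #high-join = trans (length-filter-≡ (λ x → 2 ≤? V.head x) (elems-unique join) (UP.map⁺ ∷-injectiveʳ (elems-unique K)) to from)
                     (LP.length-map (V._∷_ 2) (elems K))
    where
    ∷-injectiveʳ : {v w : Point n} → (Point (suc n) ∋ 2 ∷ v) ≡ 2 ∷ w → v ≡ w
    ∷-injectiveʳ refl = refl
    to : ∀ {x} → x ∈ elems join → 2 ≤ V.head x → x ∈ map (V._∷_ 2) (elems K)
    to {a ∷ v} x∈ a≥2 with a | ∈-join⁻ x∈ | a≥2
    ... | 2                 | v∈ | _       = MP.∈-map⁺ (V._∷_ 2) v∈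
    ... | suc (suc (suc _)) | () | _
    ... | 0                 | _  | ()
    ... | 1                 | _  | s≤s ()
    from : ∀ {x} → x ∈ map (V._∷_ 2) (elems K) → x ∈ elems join × 2 ≤ V.head x
    from {a ∷ v} x∈ with refl , v∈ ← ∈-map-∷⁻ x∈ = ∈-join⁺ 2 v∈ , ≤-refl

  #extras-join : #extras join ≡ #extras A + (#nonzeros B + card K)
  #extras-join = trans (#extras-by-slices join)
    (cong₂ _+_ (cong #extras (slice-join 0)) (cong₂ _+_ (cong #nonzeros (slice-join 1)) #high-join))

  module _ (A↓ : DownClosed A) (B↓ : DownClosed B) (K↓ : DownClosed K)
           (B⊆A : elems B ⊆ elems A) (K⊆B : elems K ⊆ elems B) where

    layer-downClosed : ∀ a → DownClosed (layer a)
    layer-downClosed 0 = A↓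
    layer-downClosed 1 = B↓
    layer-downClosed 2 = K↓
    layer-downClosed (suc (suc (suc _))) = ∅-downClosed

    layer-antitone : ∀ {a b} → b ≤ a → elems (layer a) ⊆ elems (layer b)
    layer-antitone {0}                 z≤n             = id
    layer-antitone {1}                 z≤n             = B⊆A
    layer-antitone {1}                 (s≤s z≤n)       = id
    layer-antitone {2}                 z≤n             = B⊆A ∘ K⊆B
    layer-antitone {2}                 (s≤s z≤n)       = K⊆B
    layer-antitone {2}                 (s≤s (s≤s z≤n)) = id
    layer-antitone {suc (suc (suc _))} _               ()

    join-downClosed : DownClosed join
    join-downClosed (a ∷ v) (b ∷ w) x∈ (b≤a ∷ w≤v) =
      ∈-join⁺ b (layer-downClosed b v w (layer-antitone b≤a (∈-join⁻ x∈)) w≤v)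

join-Config : {e n : ℕ} {A B K : FinSubset n} → Config e A → DownClosed B → DownClosed K → origin ∈ elems B →
  elems B ⊆ elems A → elems K ⊆ elems B → Config (e + (#nonzeros B + card K)) (join A B K)
join-Config {A = A} {B} {K} c B↓ K↓ o∈B B⊆A K⊆B = record
  { downClosed = join-downClosed A B K downClosed B↓ K↓ B⊆A K⊆B
  ; origin∈    = ∈-join⁺ A B K 0 origin∈
  ; unit∈      = λ { fz → ∈-join⁺ A B K 1 o∈B ; (fs i) → ∈-join⁺ A B K 0 (unit∈ i) }
  ; #extras≡   = trans (#extras-join A B K) (cong (_+ (#nonzeros B + card K)) #extras≡)
  }
  where open Config c

module _ {n : ℕ} (Λ : FinSubset (suc n)) where

  Uses-fs-of-0 : ∀ {i v} → (0 ∷ v) ∈ elems Λ → 0 < lookup v i → 2 ≤ degree v → Uses Λ (fs i)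
  Uses-fs-of-0 {v = v} x∈ vᵢ>0 d≥2 = 0 ∷ v , x∈ , vᵢ>0 , d≥2

  Uses-fs-of-unit : ∀ {i} → (1 ∷ unit i) ∈ elems Λ → Uses Λ (fs i)
  Uses-fs-of-unit {i} x∈ = 1 ∷ unit i , x∈ , ≤-reflexive (sym (lookup-unit i)) , s≤s (≤-reflexive (sym (degree-unit i)))

  Uses-fz-of-1 : ∀ {v} → (1 ∷ v) ∈ elems Λ → 0 < degree v → Uses Λ fz
  Uses-fz-of-1 {v} x∈ d>0 = 1 ∷ v , x∈ , s≤s z≤n , s≤s d>0

  Uses-fz-of-2 : ∀ {v} → (2 ∷ v) ∈ elems Λ → Uses Λ fz
  Uses-fz-of-2 {v} x∈ = 2 ∷ v , x∈ , s≤s z≤n , s≤s (s≤s z≤n)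

  Uses-fs⁻ : DownClosed Λ → ∀ {i} → Uses Λ (fs i) → Uses (slice 0 Λ) i ⊎ unit i ∈ elems (slice 1 Λ)
  Uses-fs⁻ _ (zero  ∷ v , x∈ , vᵢ>0 , d≥2) = inj₁ (v , ∈-slice⁺ Λ x∈ , vᵢ>0 , d≥2)
  Uses-fs⁻ Λ↓ {i} (suc a ∷ v , x∈ , vᵢ>0 , _) =
    inj₂ (∈-slice⁺ Λ (Λ↓ (suc a ∷ v) (1 ∷ unit i) x∈ (s≤s z≤n ∷ unit-≤ᶜ v i vᵢ>0)))

  Uses-fz⁻ : Uses Λ fz → 0 < #nonzeros (slice 1 Λ) + #high Λ
  Uses-fz⁻ (1 ∷ v , x∈ , _ , s≤s d>0) =
    ≤-trans (MP.∈-length (MP.∈-filter⁺ (λ x → 1 ≤? degree x) (∈-slice⁺ Λ x∈) d>0)) (m≤m+n _ _)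
  Uses-fz⁻ (suc (suc a) ∷ v , x∈ , _ , _) =
    ≤-trans (MP.∈-length (MP.∈-filter⁺ (λ x → 2 ≤? V.head x) x∈ (s≤s (s≤s z≤n)))) (m≤n+m _ _)

#used : {n : ℕ} → FinSubset n → ℕ
#used {n} A = length (filter (Uses? A) (L.allFin n))

unitsIn : {n : ℕ} → FinSubset n → List (Fin n)
unitsIn {n} B = filter (λ i → Any.any? (unit i ≟ᵖ_) (elems B)) (L.allFin n)

length-unitsIn : {n : ℕ} (B : FinSubset n) → length (unitsIn B) ≤ #nonzeros B
length-unitsIn {n} B = subst (_≤ #nonzeros B) (LP.length-map unit (unitsIn B))
  (length-mono-⊆ (UP.map⁺ unit-injective (UP.filter⁺ _ (UP.allFin⁺ n))) ⊆nonzeros)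
  where
  ⊆nonzeros : map unit (unitsIn B) ⊆ nonzeros B
  ⊆nonzeros x∈ with MP.∈-map⁻ unit x∈
  ... | (i , i∈ , refl) = MP.∈-filter⁺ (λ x → 1 ≤? degree x)
          (proj₂ (MP.∈-filter⁻ (λ i → Any.any? (unit i ≟ᵖ_) (elems B)) {xs = L.allFin n} i∈)) (≤-reflexive (sym (degree-unit i)))

length-filter-tabulate-fs : {n : ℕ} {P : Fin (suc n) → Set} (P? : Decidable P) →
  length (filter P? (L.tabulate {n = n} fs)) ≡ length (filter (P? ∘ fs) (L.allFin n))
length-filter-tabulate-fs {n} P? =
  trans (cong (length ∘ filter P?) (sym (LP.map-tabulate id fs))) (length-filter-map P? fs (L.allFin n))

#used≤2*#extras : {n : ℕ} (A : FinSubset n) → DownClosed A → #used A ≤ 2 * #extras A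
#used≤2*#extras {zero}  A _  = z≤n
#used≤2*#extras {suc n} A A↓ = subst (λ E → #used A ≤ 2 * E) (sym (#extras-by-slices A)) bound
  where
  E₀ = #extras (slice 0 A)
  a  = #nonzeros (slice 1 A)
  r  = #high A
  X  = length (filter (Uses? A) (L.tabulate {n = n} fs))
  X≤ : X ≤ 2 * E₀ + a
  X≤ = begin
    X                                                           ≡⟨ length-filter-tabulate-fs (Uses? A) ⟩
    length (filter (Uses? A ∘ fs) (L.allFin n))                 ≤⟨ length-filter-∪ (Uses? A ∘ fs) (Uses? (slice 0 A))
                                                                     (λ i → Any.any? (unit i ≟ᵖ_) (elems (slice 1 A)))
                                                                     (Uses-fs⁻ A A↓) (L.allFin n) ⟩
    #used (slice 0 A) + length (unitsIn (slice 1 A))           ≤⟨ +-mono-≤ (#used≤2*#extras (slice 0 A) (slice-downClosed 0 A A↓))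
                                                                            (length-unitsIn (slice 1 A)) ⟩
    2 * E₀ + a                                                  ∎
    where open ≤-Reasoning
  regroup : ∀ E₀ a r → 2 * E₀ + a + (a + r) + r ≡ 2 * (E₀ + (a + r))
  regroup = ℕ-Solver.solve-∀
  bound : #used A ≤ 2 * (E₀ + (a + r))
  bound with Uses? A fz
  ... | yes uses-fz = begin
    #used A                    ≡⟨ cong length (LP.filter-accept (Uses? A) uses-fz) ⟩
    suc X                      ≡⟨ +-comm 1 X ⟩
    X + 1                      ≤⟨ +-mono-≤ X≤ (Uses-fz⁻ A uses-fz) ⟩
    2 * E₀ + a + (a + r)       ≤⟨ m≤m+n _ r ⟩
    2 * E₀ + a + (a + r) + r   ≡⟨ regroup E₀ a r ⟩
    2 * (E₀ + (a + r))         ∎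
    where open ≤-Reasoning
  ... | no ¬uses-fz = begin
    #used A                    ≡⟨ cong length (LP.filter-reject (Uses? A) ¬uses-fz) ⟩
    X                          ≤⟨ X≤ ⟩
    2 * E₀ + a                 ≤⟨ m≤m+n _ (a + r) ⟩
    2 * E₀ + a + (a + r)       ≤⟨ m≤m+n _ r ⟩
    2 * E₀ + a + (a + r) + r   ≡⟨ regroup E₀ a r ⟩
    2 * (E₀ + (a + r))         ∎
    where open ≤-Reasoning

star : {n : ℕ} → List (Fin n) → FinSubset n
star is = fromList (origin ∷ map unit is)

module _ {n : ℕ} where

  ∈-star⁻ : ∀ {is x} → x ∈ elems (star {n} is) → x ≡ origin ⊎ ∃ λ i → i ∈ is × x ≡ unit i
  ∈-star⁻ {is} x∈ with ∈-fromList⁻ (origin ∷ map unit is) x∈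
  ... | here x≡o  = inj₁ x≡o
  ... | there x∈′ = inj₂ (MP.∈-map⁻ unit x∈′)

  origin∈star : ∀ is → origin ∈ elems (star {n} is)
  origin∈star is = ∈-fromList⁺ (origin ∷ map unit is) (here refl)

  unit∈star⁺ : ∀ {is i} → i ∈ is → unit i ∈ elems (star {n} is)
  unit∈star⁺ {is} i∈ = ∈-fromList⁺ (origin ∷ map unit is) (there (MP.∈-map⁺ unit i∈))

  unit∈star⁻ : ∀ {is i} → unit i ∈ elems (star {n} is) → i ∈ is
  unit∈star⁻ {i = i} u∈ with ∈-star⁻ u∈
  ... | inj₁ uᵢ≡o              = contradiction uᵢ≡o (unit≢origin i)
  ... | inj₂ (j , j∈ , uᵢ≡uⱼ) = subst (_∈ _) (sym (unit-injective uᵢ≡uⱼ)) j∈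

  star-downClosed : ∀ is → DownClosed (star {n} is)
  star-downClosed is x y x∈ y≤x with ∈-star⁻ {is} x∈
  ... | inj₁ refl = subst (_∈ elems (star is)) (sym (degree≡0⇒origin y y-degree≡0)) (origin∈star is)
    where
    y-degree≡0 = n≤0⇒n≡0 (≤-trans (degree-mono-≤ᶜ y≤x) (≤-reflexive (degree-origin {n})))
  ... | inj₂ (i , i∈ , refl) with ≤ᶜ-unit i y≤x
  ...   | inj₁ refl = origin∈star is
  ...   | inj₂ refl = x∈

  star⊆ : ∀ is {A : FinSubset n} → origin ∈ elems A → (∀ i → unit i ∈ elems A) → elems (star is) ⊆ elems A
  star⊆ is o∈A unit∈A x∈ with ∈-star⁻ {is} x∈
  ... | inj₁ refl            = o∈A
  ... | inj₂ (i , _ , refl) = unit∈A i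

  #nonzeros-star : ∀ {is} → Unique is → #nonzeros (star {n} is) ≡ length is
  #nonzeros-star {is} u = trans
    (length-filter-≡ (λ x → 1 ≤? degree x) (elems-unique (star is)) (UP.map⁺ unit-injective u) to from)
    (LP.length-map unit is)
    where
    to : ∀ {x} → x ∈ elems (star is) → 1 ≤ degree x → x ∈ map unit is
    to x∈ d≥1 with ∈-star⁻ x∈
    ... | inj₁ refl            = contradiction (≤-trans d≥1 (≤-reflexive (degree-origin {n}))) λ ()
    ... | inj₂ (i , i∈ , refl) = MP.∈-map⁺ unit i∈
    from : ∀ {x} → x ∈ map unit is → x ∈ elems (star is) × 1 ≤ degree x
    from x∈ with MP.∈-map⁻ unit x∈
    ... | (i , i∈ , refl) = unit∈star⁺ i∈ , ≤-reflexive (sym (degree-unit i))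

  card-star-[] : card (star {n} []) ≡ 1
  card-star-[] = card-≡ (star {n} []) {origin ∷ []} ([] ∷ []) (∈-fromList⁻ (origin ∷ [])) (∈-fromList⁺ (origin ∷ []))

  ≡star : ∀ {is} {B : FinSubset n} → Unique is → origin ∈ elems B → (∀ {i} → i ∈ is → unit i ∈ elems B) →
          #nonzeros B ≤ length is → B ≡ star is
  ≡star {is} {B} u o∈B units∈B #≤ = FinSubset-ext B (star is) B⊆ (star⊆′)
    where
    nonzeros⊆ : nonzeros B ⊆ map unit is
    nonzeros⊆ = ⊆-length⇒⊇ _≟ᵖ_ (UP.map⁺ unit-injective u)
      (λ x∈ → let (i , i∈ , x≡) = MP.∈-map⁻ unit x∈ in
              subst (_∈ nonzeros B) (sym x≡) (MP.∈-filter⁺ (λ x → 1 ≤? degree x) (units∈B i∈) (≤-reflexive (sym (degree-unit i)))))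
      (≤-trans #≤ (≤-reflexive (sym (LP.length-map unit is))))
    B⊆ : elems B ⊆ elems (star is)
    B⊆ {x} x∈ with degree x ℕ.≟ 0
    ... | yes d≡0 = subst (_∈ elems (star is)) (sym (degree≡0⇒origin x d≡0)) (origin∈star is)
    ... | no  d≢0 = let (i , i∈ , x≡) = MP.∈-map⁻ unit (nonzeros⊆ (MP.∈-filter⁺ (λ x → 1 ≤? degree x) x∈ (n≢0⇒n>0 d≢0))) in
                    subst (_∈ elems (star is)) (sym x≡) (unit∈star⁺ i∈)
    star⊆′ : elems (star is) ⊆ elems B
    star⊆′ x∈ with ∈-star⁻ x∈
    ... | inj₁ refl            = o∈B
    ... | inj₂ (i , i∈ , refl) = units∈B i∈

  ≡star-[] : ∀ {B : FinSubset n} → origin ∈ elems B → #nonzeros B ≡ 0 → B ≡ star []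
  ≡star-[] o∈B #≡0 = ≡star [] o∈B (λ ()) (≤-reflexive #≡0)

  ≡star-[-] : ∀ {B : FinSubset n} → DownClosed B → origin ∈ elems B → #nonzeros B ≡ 1 → ∃ λ j → B ≡ star (j ∷ [])
  ≡star-[-] {B} B↓ o∈B #≡1 with nonzeros B in eq | #≡1
  ... | w ∷ [] | _ = j , ≡star ([] ∷ []) o∈B (λ { (here refl) → uⱼ∈B }) (≤-reflexive #≡1)
    where
    w∈ = MP.∈-filter⁻ (λ x → 1 ≤? degree x) {xs = elems B} (subst (w ∈_) (sym eq) (here refl))
    j = proj₁ (degree>0⇒lookup>0 w (proj₂ w∈))
    uⱼ∈B : unit j ∈ elems B
    uⱼ∈B = B↓ w (unit j) (proj₁ w∈) (unit-≤ᶜ w j (proj₂ (degree>0⇒lookup>0 w (proj₂ w∈))))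

-- Configurations that use every coordinate

-- The parameters are those of FirstSlice below: E₀ extras in the slice x₀ = 0, a nonzero points in the
-- slice x₀ = 1, r points with x₀ ≥ 2, and u coordinates not used by the slice x₀ = 0.
data SliceShape (e E₀ a r u : ℕ) : Set where
  paired  : a ≡ 1 → r ≡ 0 → E₀ ≡ e → SliceShape e E₀ a r u
  forked  : a ≡ 2 → r ≡ 0 → u ≡ 2 → suc E₀ ≡ e → SliceShape e E₀ a r u
  squared : a ≡ 0 → r ≡ 1 → u ≡ 0 → E₀ ≡ e → SliceShape e E₀ a r u

a+2r≤2 : ∀ {e E₀ a r} c → E₀ + (a + r) ≡ suc e → c + 2 * e ≤ 2 * E₀ + a → c + (a + 2 * r) ≤ 2
a+2r≤2 {e} {E₀} {a} {r} c extras-sum bound = +-cancelˡ-≤ (2 * E₀ + a) _ _ (begin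
  2 * E₀ + a + (c + (a + 2 * r)) ≡⟨ regroup E₀ a r c ⟩
  c + 2 * (E₀ + (a + r))         ≡⟨ cong (λ s → c + 2 * s) extras-sum ⟩
  c + 2 * suc e                  ≡⟨ shift c e ⟩
  2 + (c + 2 * e)                ≤⟨ +-monoʳ-≤ 2 bound ⟩
  2 + (2 * E₀ + a)               ≡⟨ +-comm 2 _ ⟩
  2 * E₀ + a + 2                 ∎)
  where
  open ≤-Reasoning
  regroup : ∀ E₀ a r c → 2 * E₀ + a + (c + (a + 2 * r)) ≡ c + 2 * (E₀ + (a + r))
  regroup = ℕ-Solver.solve-∀
  shift : ∀ c e → c + 2 * suc e ≡ 2 + (c + 2 * e)
  shift = ℕ-Solver.solve-∀

E₀+k≡e : ∀ {e E₀ a r k} → E₀ + (a + r) ≡ suc e → a + r ≡ suc k → E₀ + k ≡ e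
E₀+k≡e {E₀ = E₀} {k = k} extras-sum a+r≡ =
  suc-injective (trans (sym (+-suc E₀ k)) (trans (cong (λ s → E₀ + s) (sym a+r≡)) extras-sum))

perfect-shape : ∀ {e E₀} a r → E₀ + (a + r) ≡ suc e → 1 + 2 * e ≤ 2 * E₀ + a → 0 < a + r →
  a ≡ 1 × r ≡ 0 × E₀ ≡ e
perfect-shape 1 0 extras-sum _ _ = refl , refl , trans (sym (+-identityʳ _)) (E₀+k≡e {a = 1} {0} {0} extras-sum refl)
perfect-shape 0 0 _ _ ()
perfect-shape (suc (suc a)) r extras-sum bound _ with a+2r≤2 {a = suc (suc a)} {r} 1 extras-sum bound
... | s≤s (s≤s ())
perfect-shape 0 (suc r) extras-sum bound _ with a+2r≤2 {a = 0} {suc r} 1 extras-sum bound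
... | s≤s le = contradiction (≤-trans (m≤m+n 2 (2 * r)) (≤-trans (≤-reflexive (sym (*-suc 2 r))) le)) λ { (s≤s ()) }
perfect-shape 1 (suc r) extras-sum bound _ with a+2r≤2 {a = 1} {suc r} 1 extras-sum bound
... | s≤s (s≤s le) = contradiction (≤-trans (m≤m+n 2 (2 * r)) (≤-trans (≤-reflexive (sym (*-suc 2 r))) le)) λ ()

nearPerfect-shape : ∀ {e E₀ u} a r → E₀ + (a + r) ≡ suc e → 2 * e ≤ 2 * E₀ + u → u ≤ a → 0 < a + r →
  SliceShape e E₀ a r u
nearPerfect-shape {e} {E₀} {u} a r extras-sum bound u≤a a+r>0 = go a r (a+2r≤2 {e} {E₀} {a} {r} 0 extras-sum bound′) extras-sum u≤a a+r>0
  where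
  bound′ : 0 + 2 * e ≤ 2 * E₀ + a
  bound′ = ≤-trans bound (+-monoʳ-≤ (2 * E₀) u≤a)
  go : ∀ a r → a + 2 * r ≤ 2 → E₀ + (a + r) ≡ suc e → u ≤ a → 0 < a + r → SliceShape e E₀ a r u
  go 0 0 _ _ _ ()
  go 1 0 _ sum _ _ = paired refl refl (trans (sym (+-identityʳ E₀)) (E₀+k≡e {a = 1} {0} {0} sum refl))
  go 2 0 _ sum u≤2 _ = forked refl refl (≤-antisym u≤2 2≤u) sucE₀≡e
    where
    sucE₀≡e : suc E₀ ≡ e
    sucE₀≡e = trans (+-comm 1 E₀) (E₀+k≡e {a = 2} {0} {1} sum refl)
    2≤u : 2 ≤ u
    2≤u = +-cancelˡ-≤ (2 * E₀) 2 u (begin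
      2 * E₀ + 2     ≡⟨ double-suc E₀ ⟩
      2 * suc E₀     ≡⟨ cong (2 *_) sucE₀≡e ⟩
      2 * e          ≤⟨ bound ⟩
      2 * E₀ + u     ∎)
      where
      open ≤-Reasoning
      double-suc : ∀ m → 2 * m + 2 ≡ 2 * suc m
      double-suc = ℕ-Solver.solve-∀
  go (suc (suc (suc a))) r (s≤s (s≤s ())) _ _ _
  go 0 1 _ sum u≤0 _ = squared refl refl (n≤0⇒n≡0 u≤0) (trans (sym (+-identityʳ E₀)) (E₀+k≡e {a = 0} {1} {0} sum refl))
  go 0 (suc (suc r)) le _ _ _ = contradiction (≤-trans (≤-reflexive (sym (*-suc 2 (suc r)))) le) λ { (s≤s (s≤s ())) }
  go (suc a) (suc r) le _ _ _ = contradiction (≤-trans (s≤s (≤-trans (≤-reflexive (sym (*-suc 2 r))) (m≤n+m _ a))) le) λ { (s≤s (s≤s ())) }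

module FirstSlice {e n : ℕ} (B : FinSubset (suc n)) (c : Config (suc e) B) (used : ∀ i → Uses B i) where

  open Config c

  B₀ B₁ : FinSubset n
  B₀ = slice 0 B
  B₁ = slice 1 B

  E₀ a r u : ℕ
  E₀ = #extras B₀
  a  = #nonzeros B₁
  r  = #high B
  u  = length (filter (¬? ∘ Uses? B₀) (L.allFin n))

  extras-sum : E₀ + (a + r) ≡ suc e
  extras-sum = trans (sym (#extras-by-slices B)) #extras≡

  B₀-Config : Config E₀ B₀
  B₀-Config = record
    { downClosed = slice-downClosed 0 B downClosed
    ; origin∈    = ∈-slice⁺ B origin∈
    ; unit∈      = λ i → ∈-slice⁺ B (unit∈ (fs i))
    ; #extras≡   = refl
    }

  B₁-downClosed : DownClosed B₁
  B₁-downClosed = slice-downClosed 1 B downClosed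

  origin∈B₁ : origin ∈ elems B₁
  origin∈B₁ = ∈-slice⁺ B (unit∈ fz)

  unit∈B₁ : ∀ {i} → ¬ Uses B₀ i → unit i ∈ elems B₁
  unit∈B₁ {i} ¬uses = [ flip contradiction ¬uses , id ]′ (Uses-fs⁻ B downClosed (used (fs i)))

  u≤a : u ≤ a
  u≤a = ≤-trans (length-filter-mono (¬? ∘ Uses? B₀) (λ i → Any.any? (unit i ≟ᵖ_) (elems B₁))
                   unit∈B₁ (L.allFin n))
                (length-unitsIn B₁)

  n≤2E₀+u : n ≤ 2 * E₀ + u
  n≤2E₀+u = subst (_≤ 2 * E₀ + u) (trans (length-filter-∁ (Uses? B₀) (L.allFin n)) (LP.length-tabulate id))
    (+-monoˡ-≤ u (#used≤2*#extras B₀ (slice-downClosed 0 B downClosed)))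

  a+r>0 : 0 < a + r
  a+r>0 = Uses-fz⁻ B (used fz)

  B≡join : (K : FinSubset n) → (∀ {v} → v ∈ elems K → (2 ∷ v) ∈ elems B) →
           (∀ {b v} → (suc (suc b) ∷ v) ∈ elems B → b ≡ 0 × v ∈ elems K) → B ≡ join B₀ B₁ K
  B≡join K K⊆ high⊆ = FinSubset-ext B (join B₀ B₁ K) B⊆ ⊆B
    where
    B⊆ : elems B ⊆ elems (join B₀ B₁ K)
    B⊆ {0 ∷ v}           x∈ = ∈-join⁺ B₀ B₁ K 0 (∈-slice⁺ B x∈)
    B⊆ {1 ∷ v}           x∈ = ∈-join⁺ B₀ B₁ K 1 (∈-slice⁺ B x∈)
    B⊆ {suc (suc b) ∷ v} x∈ with high⊆ x∈
    ... | refl , v∈K = ∈-join⁺ B₀ B₁ K 2 v∈K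
    ⊆B : elems (join B₀ B₁ K) ⊆ elems B
    ⊆B {a ∷ v} x∈ with a | ∈-join⁻ B₀ B₁ K x∈
    ... | 0                 | v∈ = ∈-slice⁻ B v∈
    ... | 1                 | v∈ = ∈-slice⁻ B v∈
    ... | 2                 | v∈ = K⊆ v∈
    ... | suc (suc (suc _)) | ()

  private
    high∈ : ∀ {x} → x ∈ elems B → 2 ≤ V.head x → x ∈ filter (λ x → 2 ≤? V.head x) (elems B)
    high∈ = MP.∈-filter⁺ (λ x → 2 ≤? V.head x)

  B≡join-∅ : r ≡ 0 → B ≡ join B₀ B₁ ∅
  B≡join-∅ r≡0 = B≡join ∅ (λ ()) (λ x∈ → contradiction (subst (0 <_) r≡0 (MP.∈-length (high∈ x∈ (s≤s (s≤s z≤n))))) λ ())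

  B≡join-star : r ≡ 1 → B ≡ join B₀ B₁ (star [])
  B≡join-star r≡1 = B≡join (star []) K⊆ high⊆
    where
    high-unique : ∀ {x y} → x ∈ elems B → 2 ≤ V.head x → y ∈ elems B → 2 ≤ V.head y → x ≡ y
    high-unique x∈ hx y∈ hy = length≡1⇒∈-≡ {xs = filter (λ x → 2 ≤? V.head x) (elems B)} r≡1 (high∈ x∈ hx) (high∈ y∈ hy)
    2e₀∈ : ∀ {x} → x ∈ elems B → 2 ≤ V.head x → (2 ∷ origin) ∈ elems B
    2e₀∈ {a ∷ v} x∈ a≥2 = downClosed (a ∷ v) (2 ∷ origin) x∈ (a≥2 ∷ origin-≤ᶜ v)
    high⊆ : ∀ {b v} → (suc (suc b) ∷ v) ∈ elems B → b ≡ 0 × v ∈ elems (star [])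
    high⊆ x∈ with high-unique x∈ (s≤s (s≤s z≤n)) (2e₀∈ x∈ (s≤s (s≤s z≤n))) ≤-refl
    ... | refl = refl , origin∈star []
    K⊆ : ∀ {v} → v ∈ elems (star []) → (2 ∷ v) ∈ elems B
    K⊆ v∈ with ∈-star⁻ {is = []} v∈ | length>0⇒∈ {xs = filter (λ x → 2 ≤? V.head x) (elems B)} (≤-reflexive (sym r≡1))
    ... | inj₁ refl | (w , w∈) = let (w∈B , hw) = MP.∈-filter⁻ (λ x → 2 ≤? V.head x) {xs = elems B} w∈ in 2e₀∈ w∈B hw

record Fork (n : ℕ) : Set where
  constructor fork
  field
    low high : Fin n
    .low<high : low F.< high

liftFork : {n : ℕ} → Fork n → Fork (suc n)
liftFork (fork j k j<k) = fork (fs j) (fs k) (s≤s j<k)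

forks : (n : ℕ) → List (Fork n)
forks zero    = []
forks (suc n) = map (λ k → fork fz (fs k) (s≤s z≤n)) (L.allFin n) ++ map liftFork (forks n)

∈-forks : {n : ℕ} (f : Fork n) → f ∈ forks n
∈-forks {suc n} (fork fz     (fs k) _)   = MP.∈-++⁺ˡ (MP.∈-map⁺ (λ k → fork fz (fs k) (s≤s z≤n)) (MP.∈-allFin k))
∈-forks {suc n} (fork (fs j) (fs k) j<k) =
  MP.∈-++⁺ʳ (map (λ k → fork fz (fs k) (s≤s z≤n)) (L.allFin n)) (MP.∈-map⁺ liftFork (∈-forks (fork j k (≤-pred j<k))))

forks-unique : (n : ℕ) → Unique (forks n)
forks-unique zero    = []
forks-unique (suc n) = UP.++⁺ (UP.map⁺ (λ { refl → refl }) (UP.allFin⁺ n)) (UP.map⁺ liftFork-injective (forks-unique n)) disjoint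
  where
  liftFork-injective : {f g : Fork n} → liftFork f ≡ liftFork g → f ≡ g
  liftFork-injective {fork _ _ _} {fork _ _ _} refl = refl
  disjoint : ∀ {f} → ¬ (f ∈ map (λ k → fork fz (fs k) (s≤s z≤n)) (L.allFin n) × f ∈ map liftFork (forks n))
  disjoint (f∈₁ , f∈₂) with MP.∈-map⁻ _ f∈₁ | MP.∈-map⁻ liftFork f∈₂
  ... | (_ , _ , refl) | (fork _ _ _ , _ , ())

length-forks : (n : ℕ) → length (forks n) ≡ n C 2
length-forks zero    = refl
length-forks (suc n) = begin
  length (map _ (L.allFin n) ++ map liftFork (forks n))   ≡⟨ LP.length-++ (map _ (L.allFin n)) ⟩
  length (map _ (L.allFin n)) + length (map liftFork (forks n))
    ≡⟨ cong₂ _+_ (trans (LP.length-map _ (L.allFin n)) (trans (LP.length-tabulate id) (sym (nC1≡n n))))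
                 (trans (LP.length-map liftFork (forks n)) (length-forks n)) ⟩
  n C 1 + n C 2                                            ≡⟨ nCk+nC[k+1]≡[n+1]C[k+1] n 1 ⟩
  suc n C 2                                                ∎
  where open ≡-Reasoning

-- How the first coordinate enters the extras: through e₀ + eⱼ, through e₀ + eⱼ and e₀ + eₖ, or through 2e₀.
data Kind (n : ℕ) : Set where
  paired  : Fin n → Kind n
  forked  : Fork n → Kind n
  squared : Kind n

module _ {n : ℕ} where

  layer₁ : Kind n → FinSubset n
  layer₁ (paired j)            = star (j ∷ [])
  layer₁ (forked (fork j k _)) = star (j ∷ k ∷ [])
  layer₁ squared               = star []

  layer₂ : Kind n → FinSubset n
  layer₂ (paired _) = ∅
  layer₂ (forked _) = ∅
  layer₂ squared    = star []

  attach : Kind n → FinSubset n → FinSubset (suc n)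
  attach κ A = join A (layer₁ κ) (layer₂ κ)

  slicePattern : Kind n → Pattern n
  slicePattern (paired j)            = allRequired [ j ]≔ free
  slicePattern (forked (fork j k _)) = (allRequired [ j ]≔ forbidden) [ k ]≔ forbidden
  slicePattern squared               = allRequired

  sliceExtras : ℕ → Kind n → ℕ
  sliceExtras e (paired _) = e
  sliceExtras e (forked _) = e ∸ 1
  sliceExtras e squared    = e

  SliceOf : ℕ → Kind n → FinSubset n → Set
  SliceOf e κ = ConfigOn (sliceExtras e κ) (slicePattern κ)

  slice-attach : ∀ κ A → slice 0 (attach κ A) ≡ A
  slice-attach κ A = slice-join A (layer₁ κ) (layer₂ κ) 0

  fork-distinct : (f : Fork n) → Fork.low f ≢ Fork.high f
  fork-distinct (fork j k j<k) refl = <-irrefl refl (recompute (j F.<? k) j<k)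

  attach-injective : ∀ κ κ′ {A A′} → attach κ A ≡ attach κ′ A′ → κ ≡ κ′
  attach-injective κ κ′ {A} {A′} eq = go κ κ′ layers₁ layers₂
    where
    layers₁ : layer₁ κ ≡ layer₁ κ′
    layers₁ = trans (sym (slice-join A (layer₁ κ) (layer₂ κ) 1))
                    (trans (cong (slice 1) eq) (slice-join A′ (layer₁ κ′) (layer₂ κ′) 1))
    layers₂ : layer₂ κ ≡ layer₂ κ′
    layers₂ = trans (sym (slice-join A (layer₁ κ) (layer₂ κ) 2))
                    (trans (cong (slice 2) eq) (slice-join A′ (layer₁ κ′) (layer₂ κ′) 2))
    ∅≢star : ∅ ≢ star {n} []
    ∅≢star ∅≡ = case subst (λ X → origin ∈ elems X) (sym ∅≡) (origin∈star []) of λ ()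
    #paired : ∀ j → #nonzeros (layer₁ (paired j)) ≡ 1
    #paired j = #nonzeros-star {is = j ∷ []} ([] ∷ [])
    #forked : ∀ f → #nonzeros (layer₁ (forked f)) ≡ 2
    #forked f@(fork j k _) = #nonzeros-star {is = j ∷ k ∷ []} ((fork-distinct f ∷ []) ∷ [] ∷ [])
    moved : ∀ i {is is′} → star is ≡ star is′ → i ∈ is → i ∈ is′
    moved i {is} {is′} eq i∈ = unit∈star⁻ {is = is′} (subst (λ X → unit i ∈ elems X) eq (unit∈star⁺ i∈))
    go : ∀ κ κ′ → layer₁ κ ≡ layer₁ κ′ → layer₂ κ ≡ layer₂ κ′ → κ ≡ κ′
    go (paired j) (paired j′) eq₁ _ with moved j {j ∷ []} {j′ ∷ []} eq₁ (here refl)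
    ... | here refl = refl
    go (paired j) (forked f) eq₁ _ = case trans (sym (#paired j)) (trans (cong #nonzeros eq₁) (#forked f)) of λ ()
    go (forked f) (paired j) eq₁ _ = case trans (sym (#forked f)) (trans (cong #nonzeros eq₁) (#paired j)) of λ ()
    go (forked (fork j k j<k)) (forked (fork j′ k′ j′<k′)) eq₁ _
      with moved j {j ∷ k ∷ []} {j′ ∷ k′ ∷ []} eq₁ (here refl) | moved k {j ∷ k ∷ []} {j′ ∷ k′ ∷ []} eq₁ (there (here refl))
         | moved j′ {j′ ∷ k′ ∷ []} {j ∷ k ∷ []} (sym eq₁) (here refl)
    ... | here refl         | here refl         | _                 = ⊥-elim (<-irrefl refl (recompute (j F.<? k) j<k))
    ... | here refl         | there (here refl) | _                 = refl
    ... | there (here refl) | _                 | here refl         = ⊥-elim (<-irrefl refl (recompute (j′ F.<? k′) j′<k′))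
    ... | there (here refl) | _                 | there (here refl) =
      ⊥-elim (<-asym (recompute (j F.<? k) j<k) (recompute (j′ F.<? k′) j′<k′))
    go (paired _) squared _ eq₂ = ⊥-elim (∅≢star eq₂)
    go (forked _) squared _ eq₂ = ⊥-elim (∅≢star eq₂)
    go squared (paired _) _ eq₂ = ⊥-elim (∅≢star (sym eq₂))
    go squared (forked _) _ eq₂ = ⊥-elim (∅≢star (sym eq₂))
    go squared squared    _ _   = refl

  weight : Kind n → ℕ
  weight (paired _) = 1
  weight (forked _) = 2
  weight squared    = 1

  attach-Config : ∀ {e′} κ {A} → Config e′ A → Config (e′ + weight κ) (attach κ A)
  attach-Config {e′} κ {A} c = subst (λ e → Config e (attach κ A)) (cong (λ w → e′ + w) (layers-weight κ))
    (join-Config {A = A} {layer₁ κ} {layer₂ κ} c (layer₁-downClosed κ) (layer₂-downClosed κ) (origin∈layer₁ κ)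
      (layer₁⊆ κ) (layer₂⊆layer₁ κ))
    where
    open Config c
    layer₁-downClosed : ∀ κ → DownClosed (layer₁ κ)
    layer₁-downClosed (paired j)            = star-downClosed (j ∷ [])
    layer₁-downClosed (forked (fork j k _)) = star-downClosed (j ∷ k ∷ [])
    layer₁-downClosed squared               = star-downClosed []
    layer₂-downClosed : ∀ κ → DownClosed (layer₂ κ)
    layer₂-downClosed (paired _) = ∅-downClosed
    layer₂-downClosed (forked _) = ∅-downClosed
    layer₂-downClosed squared    = star-downClosed []
    origin∈layer₁ : ∀ κ → origin ∈ elems (layer₁ κ)
    origin∈layer₁ (paired j)            = origin∈star (j ∷ [])
    origin∈layer₁ (forked (fork j k _)) = origin∈star (j ∷ k ∷ [])
    origin∈layer₁ squared               = origin∈star []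
    layer₁⊆ : ∀ κ → elems (layer₁ κ) ⊆ elems A
    layer₁⊆ (paired j)            = star⊆ (j ∷ []) {A} origin∈ unit∈
    layer₁⊆ (forked (fork j k _)) = star⊆ (j ∷ k ∷ []) {A} origin∈ unit∈
    layer₁⊆ squared               = star⊆ [] {A} origin∈ unit∈
    layer₂⊆layer₁ : ∀ κ → elems (layer₂ κ) ⊆ elems (layer₁ κ)
    layer₂⊆layer₁ (paired _) ()
    layer₂⊆layer₁ (forked _) ()
    layer₂⊆layer₁ squared    = id
    layers-weight : ∀ κ → #nonzeros (layer₁ κ) + card (layer₂ κ) ≡ weight κ
    layers-weight (paired j)              = cong (_+ 0) (#nonzeros-star {is = j ∷ []} ([] ∷ []))
    layers-weight (forked f@(fork j k _)) = cong (_+ 0) (#nonzeros-star {is = j ∷ k ∷ []} ((fork-distinct f ∷ []) ∷ [] ∷ []))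
    layers-weight squared                 = cong₂ _+_ (#nonzeros-star {n} {is = []} []) (card-star-[] {n})

  required-off-layer₁ : ∀ κ {i} → unit i ∉ elems (layer₁ κ) → slicePattern κ i ≡ required
  required-off-layer₁ (paired j) {i} u∉ = []≔-other allRequired {i} {j} free (λ { refl → u∉ (unit∈star⁺ {is = j ∷ []} (here refl)) })
  required-off-layer₁ (forked (fork j k _)) {i} u∉ =
    trans ([]≔-other (allRequired [ j ]≔ forbidden) {i} {k} forbidden (λ { refl → u∉ (unit∈star⁺ {is = j ∷ k ∷ []} (there (here refl))) }))
          ([]≔-other allRequired {i} {j} forbidden (λ { refl → u∉ (unit∈star⁺ {is = j ∷ k ∷ []} (here refl)) }))
  required-off-layer₁ squared _ = refl

  attach-uses : ∀ κ {A} → Obeys (slicePattern κ) A → ∀ i → Uses (attach κ A) i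
  attach-uses (paired j) {A} _ fz =
    Uses-fz-of-1 (attach (paired j) A) (∈-join⁺ A (layer₁ (paired j)) ∅ 1 (unit∈star⁺ {is = j ∷ []} (here refl)))
      (≤-reflexive (sym (degree-unit j)))
  attach-uses (forked (fork j k j<k)) {A} _ fz =
    Uses-fz-of-1 (attach (forked (fork j k j<k)) A) (∈-join⁺ A (layer₁ (forked (fork j k j<k))) ∅ 1 (unit∈star⁺ {is = j ∷ k ∷ []} (here refl)))
      (≤-reflexive (sym (degree-unit j)))
  attach-uses squared {A} _ fz = Uses-fz-of-2 (attach squared A) (∈-join⁺ A (star []) (star []) 2 (origin∈star []))
  attach-uses κ {A} obeys (fs i) with Any.any? (unit i ≟ᵖ_) (elems (layer₁ κ))
  ... | yes u∈ = Uses-fs-of-unit (attach κ A) (∈-join⁺ A (layer₁ κ) (layer₂ κ) 1 u∈)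
  ... | no  u∉ with v , v∈ , vᵢ>0 , d≥2 ← Obeys-at {π = slicePattern κ} {A} (required-off-layer₁ κ u∉) obeys =
    Uses-fs-of-0 (attach κ A) (∈-join⁺ A (layer₁ κ) (layer₂ κ) 0 v∈) vᵢ>0 d≥2

kinds : (n : ℕ) → List (Kind n)
kinds n = map paired (L.allFin n) ++ map forked (forks n) ++ squared ∷ []

paired∈kinds : {n : ℕ} (j : Fin n) → paired j ∈ kinds n
paired∈kinds {n} j = MP.∈-++⁺ˡ (MP.∈-map⁺ paired (MP.∈-allFin j))

forked∈kinds : {n : ℕ} (f : Fork n) → forked f ∈ kinds n
forked∈kinds {n} f = MP.∈-++⁺ʳ (map paired (L.allFin n)) (MP.∈-++⁺ˡ (MP.∈-map⁺ forked (∈-forks f)))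

squared∈kinds : {n : ℕ} → squared ∈ kinds n
squared∈kinds {n} = MP.∈-++⁺ʳ (map paired (L.allFin n)) (MP.∈-++⁺ʳ (map forked (forks n)) (here refl))

kinds-unique : (n : ℕ) → Unique (kinds n)
kinds-unique n = UP.++⁺ (UP.map⁺ (λ { refl → refl }) (UP.allFin⁺ n))
  (UP.++⁺ (UP.map⁺ (λ { refl → refl }) (forks-unique n)) ([] ∷ []) forked≢squared) paired≢rest
  where
  forked≢squared : ∀ {κ} → ¬ (κ ∈ map forked (forks n) × κ ∈ squared ∷ [])
  forked≢squared (κ∈ , here refl) with MP.∈-map⁻ forked κ∈
  ... | (_ , _ , ())
  paired≢rest : ∀ {κ} → ¬ (κ ∈ map paired (L.allFin n) × κ ∈ map forked (forks n) ++ squared ∷ [])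
  paired≢rest (κ∈ , κ∈′) with MP.∈-map⁻ paired κ∈ | MP.∈-++⁻ (map forked (forks n)) κ∈′
  ... | (_ , _ , refl) | inj₁ κ∈f with MP.∈-map⁻ forked κ∈f
  ...   | (_ , _ , ())
  paired≢rest (κ∈ , κ∈′) | (_ , _ , refl) | inj₂ (here ())
  paired≢rest (κ∈ , κ∈′) | (_ , _ , refl) | inj₂ (there ())

ordered : {n : ℕ} {P : Fin n → Set} {i₀ i₁ : Fin n} → i₀ ≢ i₁ → P i₀ → P i₁ → ∃₂ λ j k → j F.< k × P j × P k
ordered {i₀ = i₀} {i₁} i₀≢i₁ p₀ p₁ with FP.<-cmp i₀ i₁
... | tri< i₀<i₁ _ _ = i₀ , i₁ , i₀<i₁ , p₀ , p₁
... | tri≈ _ i₀≡i₁ _ = contradiction i₀≡i₁ i₀≢i₁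
... | tri> _ _ i₁<i₀ = i₁ , i₀ , i₁<i₀ , p₁ , p₀

module Classify {e n : ℕ} (B : FinSubset (suc n)) (c : Config (suc e) B) (used : ∀ i → Uses B i) where

  open FirstSlice B c used

  private
    uses₀ : ∀ {i} → unit i ∉ elems B₁ → Uses B₀ i
    uses₀ {i} u∉ with Uses? B₀ i
    ... | yes uses = uses
    ... | no ¬uses = contradiction (unit∈B₁ ¬uses) u∉

    unused : List (Fin n)
    unused = filter (¬? ∘ Uses? B₀) (L.allFin n)

    unused⇒¬Uses : ∀ {i} → i ∈ unused → ¬ Uses B₀ i
    unused⇒¬Uses i∈ = proj₂ (MP.∈-filter⁻ (¬? ∘ Uses? B₀) {xs = L.allFin n} i∈)

  as-paired : a ≡ 1 → r ≡ 0 → E₀ ≡ e → ∃ λ j → SliceOf e (paired j) B₀ × attach (paired j) B₀ ≡ B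
  as-paired a≡1 r≡0 E₀≡e with j , B₁≡ ← ≡star-[-] {B = B₁} B₁-downClosed origin∈B₁ a≡1 =
    j , (subst (λ k → Config k B₀) E₀≡e B₀-Config , obeys) , sym (trans (B≡join-∅ r≡0) (cong (λ X → join B₀ X ∅) B₁≡))
    where
    obeys : Obeys (allRequired [ j ]≔ free) B₀
    obeys i with i F.≟ j
    ... | yes _  = tt
    ... | no i≢j = uses₀ λ u∈ → case unit∈star⁻ {is = j ∷ []} (subst (λ X → unit i ∈ elems X) B₁≡ u∈) of λ { (here i≡j) → i≢j i≡j }

  two-unused : u ≡ 2 → ∃₂ λ j k → j F.< k × ¬ Uses B₀ j × ¬ Uses B₀ k
  two-unused u≡2 with i₀ , i₁ , unused≡ ← length≡2⇒ {xs = unused} u≡2 = ordered i₀≢i₁ (¬uses (here refl)) (¬uses (there (here refl)))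
    where
    ¬uses : ∀ {i} → i ∈ i₀ ∷ i₁ ∷ [] → ¬ Uses B₀ i
    ¬uses i∈ = unused⇒¬Uses (subst (_ ∈_) (sym unused≡) i∈)
    i₀≢i₁ : i₀ ≢ i₁
    i₀≢i₁ = case subst Unique unused≡ (UP.filter⁺ (¬? ∘ Uses? B₀) (UP.allFin⁺ n)) of λ { ((i₀≢i₁ ∷ []) ∷ _) → i₀≢i₁ }

  as-forked : a ≡ 2 → r ≡ 0 → u ≡ 2 → suc E₀ ≡ e → ∃ λ f → SliceOf e (forked f) B₀ × attach (forked f) B₀ ≡ B
  as-forked a≡2 r≡0 u≡2 sucE₀≡e with j , k , j<k , ¬usesⱼ , ¬usesₖ ← two-unused u≡2 =
    fork j k j<k , (subst (λ k → Config k B₀) (cong (_∸ 1) sucE₀≡e) B₀-Config , obeys) ,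
    sym (trans (B≡join-∅ r≡0) (cong (λ X → join B₀ X ∅) B₁≡))
    where
    j≢k : j ≢ k
    j≢k j≡k = <-irrefl (cong F.toℕ j≡k) j<k
    B₁≡ : B₁ ≡ star (j ∷ k ∷ [])
    B₁≡ = ≡star ((j≢k ∷ []) ∷ [] ∷ []) origin∈B₁ (λ { (here refl) → unit∈B₁ ¬usesⱼ ; (there (here refl)) → unit∈B₁ ¬usesₖ })
                (≤-reflexive a≡2)
    obeys : Obeys ((allRequired [ j ]≔ forbidden) [ k ]≔ forbidden) B₀
    obeys i with i F.≟ k
    ... | yes refl = ¬usesₖ
    ... | no i≢k with i F.≟ j
    ...   | yes refl = ¬usesⱼ
    ...   | no i≢j = uses₀ λ u∈ → case unit∈star⁻ {is = j ∷ k ∷ []} (subst (λ X → unit i ∈ elems X) B₁≡ u∈) of λ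
                       { (here i≡j) → i≢j i≡j ; (there (here i≡k)) → i≢k i≡k }

  as-squared : a ≡ 0 → r ≡ 1 → u ≡ 0 → E₀ ≡ e → SliceOf e squared B₀ × attach squared B₀ ≡ B
  as-squared a≡0 r≡1 u≡0 E₀≡e =
    (subst (λ k → Config k B₀) E₀≡e B₀-Config , all-used) ,
    sym (trans (B≡join-star r≡1) (cong (λ X → join B₀ X (star [])) (≡star-[] {B = B₁} origin∈B₁ a≡0)))
    where
    all-used : ∀ i → Uses B₀ i
    all-used i with Uses? B₀ i
    ... | yes uses = uses
    ... | no ¬uses = contradiction (subst (0 <_) u≡0 (MP.∈-length (MP.∈-filter⁺ (¬? ∘ Uses? B₀) (MP.∈-allFin i) ¬uses))) λ ()

  classify-perfect : n ≡ suc (2 * e) → ∃ λ j → SliceOf e (paired j) B₀ × attach (paired j) B₀ ≡ B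
  classify-perfect n≡
    with a≡1 , r≡0 , E₀≡e ← perfect-shape a r extras-sum (subst (_≤ 2 * E₀ + a) n≡ (≤-trans n≤2E₀+u (+-monoʳ-≤ (2 * E₀) u≤a))) a+r>0 =
    as-paired a≡1 r≡0 E₀≡e

  classify-nearPerfect : n ≡ 2 * e → ∃ λ κ → κ ∈ kinds n × SliceOf e κ B₀ × attach κ B₀ ≡ B
  classify-nearPerfect n≡ = from-shape (nearPerfect-shape a r extras-sum (subst (_≤ 2 * E₀ + u) n≡ n≤2E₀+u) u≤a a+r>0)
    where
    from-shape : SliceShape e E₀ a r u → ∃ λ κ → κ ∈ kinds n × SliceOf e κ B₀ × attach κ B₀ ≡ B
    from-shape (paired a≡1 r≡0 E₀≡e) =
      let (j , s , eq) = as-paired a≡1 r≡0 E₀≡e in paired j , paired∈kinds j , s , eq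
    from-shape (forked a≡2 r≡0 u≡2 sucE₀≡e) =
      let (f , s , eq) = as-forked a≡2 r≡0 u≡2 sucE₀≡e in forked f , forked∈kinds f , s , eq
    from-shape (squared a≡0 r≡1 u≡0 E₀≡e) = squared , squared∈kinds , as-squared a≡0 r≡1 u≡0 E₀≡e

-- Counting configurations

#extras-dim0 : (A : FinSubset 0) → #extras A ≡ 0
#extras-dim0 A = cong length (LP.filter-none (λ x → 2 ≤? degree x) {xs = elems A} (All.tabulate λ { {[]} _ () }))

!!-odd : ∀ e → (2 * suc e ∸ 1) !! ≡ suc (2 * e) * (2 * e ∸ 1) !!
!!-odd e = trans (cong (λ m → (m ∸ 1) !!) (*-suc 2 e)) (odd e)
  where
  odd : ∀ e → suc (2 * e) !! ≡ suc (2 * e) * (2 * e ∸ 1) !!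
  odd zero    = refl
  odd (suc e) = subst (λ m → suc m !! ≡ suc m * (m ∸ 1) !!) (sym (*-suc 2 e)) refl

C2-double : ∀ e → (2 * suc e) C 2 ≡ suc e * suc (2 * e)
C2-double zero    = refl
C2-double (suc e) = begin
  (2 * suc (suc e)) C 2               ≡⟨ cong (_C 2) (*-suc 2 (suc e)) ⟩
  suc (suc m) C 2                     ≡⟨ nCk+nC[k+1]≡[n+1]C[k+1] (suc m) 1 ⟨
  suc m C 1 + suc m C 2               ≡⟨ cong₂ _+_ (nC1≡n (suc m)) (sym (nCk+nC[k+1]≡[n+1]C[k+1] m 1)) ⟩
  suc m + (m C 1 + m C 2)             ≡⟨ cong₂ (λ x y → suc m + (x + y)) (nC1≡n m) (C2-double e) ⟩
  suc m + (m + suc e * suc (2 * e))   ≡⟨ cong (λ m → suc m + (m + suc e * suc (2 * e))) (*-suc 2 e) ⟩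
  3 + 2 * e + (2 + 2 * e + suc e * suc (2 * e)) ≡⟨ regroup e ⟩
  suc (suc e) * suc (2 * suc e)       ∎
  where
  open ≡-Reasoning
  m = 2 * suc e
  regroup : ∀ e → 3 + 2 * e + (2 + 2 * e + suc e * suc (2 * e)) ≡ suc (suc e) * suc (2 * suc e)
  regroup = ℕ-Solver.solve-∀

forked-extras : ∀ e → Fork (2 * e) → e ∸ 1 + 2 ≡ suc e
forked-extras (suc e) _ = +-comm e 2
forked-extras zero (fork () _ _)

module Counts (y : ℕ → ℕ → ℕ) (hy : ∀ k d → IsY k d (y k d)) where

  private
    configs : (e n : ℕ) → HasCount (Config e {n}) (y n (suc (n + e)))
    configs e n = IsY⇒HasCount-Config (hy n (suc (n + e)))

  count : (e : ℕ) {n : ℕ} → Pattern n → ℕ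
  count e {n} π = length (filter (Obeys? π) (proj₁ (configs e n)))

  count-spec : (e : ℕ) {n : ℕ} (π : Pattern n) → HasCount (ConfigOn e π) (count e π)
  count-spec e {n} π = HasCount-filter (configs e n) (Obeys? π)

  count-unique : ∀ {e n m} {π : Pattern n} → HasCount (ConfigOn e π) m → count e π ≡ m
  count-unique {e} {π = π} = HasCount-unique (count-spec e π)

  count-cong : ∀ {e n} {π π′ : Pattern n} → (∀ i → π i ≡ π′ i) → count e π ≡ count e π′
  count-cong {e} {π = π} {π′} π≗π′ = count-unique (HasCount-resp
    (λ {A} (c , o) → c , Obeys-cong {π = π′} {A} (sym ∘ π≗π′) o)
    (λ {A} (c , o) → c , Obeys-cong {π = π} {A} π≗π′ o)
    (count-spec e π′))

  count-allFree : ∀ e n → count e {n} (λ _ → free) ≡ y n (suc (n + e))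
  count-allFree e n = count-unique (HasCount-resp (λ c → c , λ _ → tt) proj₁ (configs e n))

  count-split : ∀ {e n} {π π₁ π₂ : Pattern n} (j : Fin n) → π j ≡ free → π₁ j ≡ required → π₂ j ≡ forbidden →
    (∀ i → i ≢ j → π₁ i ≡ π i) → (∀ i → i ≢ j → π₂ i ≡ π i) → count e π ≡ count e π₁ + count e π₂
  count-split {e} {π = π} {π₁} {π₂} j πⱼ≡ π₁ⱼ≡ π₂ⱼ≡ agree₁ agree₂
    with m₁ , m₂ , c₁ , c₂ , m₁+m₂≡ ← HasCount-partition (count-spec e π) (λ A → Uses? A j) =
    trans (sym m₁+m₂≡) (sym (cong₂ _+_ (count-unique (HasCount-resp to₁ from₁ c₁)) (count-unique (HasCount-resp to₂ from₂ c₂))))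
    where
    back : ∀ {A} {π′ : Pattern _} → (∀ i → i ≢ j → π′ i ≡ π i) → Obeys π′ A → Obeys π A
    back {A} {π′} agree o = Obeys-update {π = π′} {A} j (λ i i≢j → sym (agree i i≢j)) o (subst (λ m → ⟦ m ⟧ (Uses A j)) (sym πⱼ≡) tt)
    to₁ : ∀ {A} → ConfigOn e π A × Uses A j → ConfigOn e π₁ A
    to₁ {A} ((c , o) , uses) = c , Obeys-update {π = π} {A} j agree₁ o (subst (λ m → ⟦ m ⟧ (Uses A j)) (sym π₁ⱼ≡) uses)
    from₁ : ∀ {A} → ConfigOn e π₁ A → ConfigOn e π A × Uses A j
    from₁ {A} (c , o) = (c , back {A} agree₁ o) , Obeys-at {π = π₁} {A} π₁ⱼ≡ o
    to₂ : ∀ {A} → ConfigOn e π A × ¬ Uses A j → ConfigOn e π₂ A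
    to₂ {A} ((c , o) , ¬uses) = c , Obeys-update {π = π} {A} j agree₂ o (subst (λ m → ⟦ m ⟧ (Uses A j)) (sym π₂ⱼ≡) ¬uses)
    from₂ : ∀ {A} → ConfigOn e π₂ A → ConfigOn e π A × ¬ Uses A j
    from₂ {A} (c , o) = (c , back {A} agree₂ o) , Obeys-at {π = π₂} {A} π₂ⱼ≡ o

  count-delete : ∀ {e n} {π : Pattern (suc n)} (j : Fin (suc n)) → π j ≡ forbidden → count e π ≡ count e (π ∘ punchIn j)
  count-delete {e} {π = π} j πⱼ≡ = count-unique (HasCount-widen j πⱼ≡ (count-spec e (π ∘ punchIn j)))

  #allUsed : ℕ → ℕ → ℕ
  #allUsed e n = count e (allRequired {n})

  count-free-at : ∀ {e n} (j : Fin n) → count e (allRequired [ j ]≔ free) ≡ #allUsed e n + #allUsed e (n ∸ 1)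
  count-free-at {e} {suc n} j = trans
    (count-split j ([]≔-updated _ j free) refl ([]≔-updated _ j forbidden)
      (λ i i≢j → sym ([]≔-other allRequired free i≢j))
      (λ i i≢j → trans ([]≔-other allRequired forbidden i≢j) (sym ([]≔-other allRequired free i≢j))))
    (cong (λ m → #allUsed e (suc n) + m) (trans (count-delete j ([]≔-updated _ j forbidden))
                                                (count-cong (λ i → []≔-other allRequired forbidden (FP.punchInᵢ≢i j i)))))

  count-forbidden-pair : ∀ {e n} {j k : Fin n} → j ≢ k →
    count e ((allRequired [ j ]≔ forbidden) [ k ]≔ forbidden) ≡ #allUsed e (n ∸ 2)
  count-forbidden-pair {n = suc zero} {fz} {fz} j≢k = contradiction refl j≢k
  count-forbidden-pair {e} {suc (suc n)} {j} {k} j≢k = begin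
    count e π                                 ≡⟨ count-delete j πⱼ≡ ⟩
    count e (π ∘ punchIn j)                   ≡⟨ count-delete k′ πₖ≡ ⟩
    count e (π ∘ punchIn j ∘ punchIn k′)      ≡⟨ count-cong required-elsewhere ⟩
    #allUsed e n                              ∎
    where
    open ≡-Reasoning
    π = (allRequired [ j ]≔ forbidden) [ k ]≔ forbidden
    k′ = punchOut j≢k
    πⱼ≡ : π j ≡ forbidden
    πⱼ≡ = trans ([]≔-other _ forbidden j≢k) ([]≔-updated _ j forbidden)
    πₖ≡ : π (punchIn j k′) ≡ forbidden
    πₖ≡ = trans (cong π (FP.punchIn-punchOut j≢k)) ([]≔-updated _ k forbidden)
    required-elsewhere : ∀ i → π (punchIn j (punchIn k′ i)) ≡ required
    required-elsewhere i = trans ([]≔-other _ forbidden ≢k) ([]≔-other allRequired forbidden (FP.punchInᵢ≢i j _))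
      where
      ≢k : punchIn j (punchIn k′ i) ≢ k
      ≢k eq = FP.punchInᵢ≢i k′ i (FP.punchIn-injective j _ _ (trans eq (sym (FP.punchIn-punchOut j≢k))))

  #allUsed-vanishes : ∀ {e n} → 2 * e < n → #allUsed e n ≡ 0
  #allUsed-vanishes {e} {n} 2e<n = count-unique ([] , [] , (λ A → mk⇔ (λ (c , used) → contradiction (bound c used) (<⇒≱ 2e<n)) λ ()) , refl)
    where
    bound : ∀ {A} → Config e A → (∀ i → Uses A i) → n ≤ 2 * e
    bound {A} c used = begin
      n                    ≡⟨ LP.length-tabulate id ⟨
      length (L.allFin n)  ≡⟨ cong length (LP.filter-all (Uses? A) {xs = L.allFin n} (All.tabulate (λ {i} _ → used i))) ⟨
      #used A              ≤⟨ #used≤2*#extras A (Config.downClosed c) ⟩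
      2 * #extras A        ≡⟨ cong (2 *_) (Config.#extras≡ c) ⟩
      2 * e                ∎
      where open ≤-Reasoning

  #allUsed-empty : #allUsed 0 0 ≡ 1
  #allUsed-empty = count-unique (star [] ∷ [] , [] ∷ [] , (λ A → mk⇔ to from) , refl)
    where
    to : ∀ {A} → ConfigOn 0 allRequired A → A ∈ star [] ∷ []
    to {A} (c , _) = here (FinSubset-ext A (star []) (λ { {[]} _ → origin∈star [] }) (star⊆ [] {A} (Config.origin∈ c) λ ()))
    from : ∀ {A} → A ∈ star [] ∷ [] → ConfigOn 0 allRequired A
    from (here refl) = record { downClosed = star-downClosed [] ; origin∈ = origin∈star [] ; unit∈ = λ () ; #extras≡ = #extras-dim0 (star []) } , λ ()

  y-dim0 : ∀ e → y 0 (suc (suc e)) ≡ 0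
  y-dim0 e = trans (sym (count-allFree (suc e) 0))
    (count-unique ([] , [] , (λ A → mk⇔ (λ (c , _) → case trans (sym (#extras-dim0 A)) (Config.#extras≡ c) of λ ()) λ ()) , refl))

  prefixCount : ℕ → ℕ → ℕ → ℕ
  prefixCount e n b = count e (prefix {n} b)

  prefixCount-zero : ∀ e n → prefixCount e n 0 ≡ y n (suc (n + e))
  prefixCount-zero e n = trans (count-cong (λ i → prefix-≥ {i = i} z≤n)) (count-allFree e n)

  prefixCount-diagonal : ∀ e n → prefixCount e n n ≡ #allUsed e n
  prefixCount-diagonal e n = count-cong (λ i → prefix-< (FP.toℕ<n i))

  prefixCount-suc : ∀ e n b → b ≤ n → prefixCount e (suc n) b ≡ prefixCount e (suc n) (suc b) + prefixCount e n b
  prefixCount-suc e n b b≤n = trans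
    (count-split j (prefix-≥ (≤-reflexive (sym toℕj≡b))) (prefix-< (s≤s (≤-reflexive toℕj≡b))) ([]≔-updated _ j forbidden)
      (λ i i≢j → prefix-suc (i≢j ∘ toℕ≡b⇒≡j)) (λ i i≢j → []≔-other _ forbidden i≢j))
    (cong (λ m → prefixCount e (suc n) (suc b) + m) (trans (count-delete j ([]≔-updated _ j forbidden)) (count-cong deleted)))
    where
    j = F.fromℕ< (s≤s b≤n)
    toℕj≡b : F.toℕ j ≡ b
    toℕj≡b = FP.toℕ-fromℕ< (s≤s b≤n)
    toℕ≡b⇒≡j : ∀ {i} → F.toℕ i ≡ b → i ≡ j
    toℕ≡b⇒≡j i≡b = FP.toℕ-injective (trans i≡b (sym toℕj≡b))
    deleted : ∀ i → (prefix b [ j ]≔ forbidden) (punchIn j i) ≡ prefix b i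
    deleted i = trans ([]≔-other _ forbidden (FP.punchInᵢ≢i j i))
                      (subst (λ b → prefix b (punchIn j i) ≡ prefix b i) toℕj≡b (prefix-punchIn j i))

  private
    sliceCount : ℕ → {n : ℕ} → Kind n → ℕ
    sliceCount e κ = count (sliceExtras e κ) (slicePattern κ)

  #allUsed-by-kinds : ∀ {e n} (is : List (Kind n)) → Unique is →
    (∀ {κ A} → κ ∈ is → Config (sliceExtras e κ) A → Config (suc e) (attach κ A)) →
    (∀ {B} → ConfigOn (suc e) allRequired B → ∃ λ κ → κ ∈ is × SliceOf e κ (slice 0 B) × attach κ (slice 0 B) ≡ B) →
    #allUsed (suc e) (suc n) ≡ sum (map (sliceCount e) is)
  #allUsed-by-kinds {e} is u config complete = count-unique
    (HasCount-⨆ (λ κ → count-spec (sliceExtras e κ) (slicePattern κ)) attach (λ _ → slice 0) (λ κ {A} _ → slice-attach κ A)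
      (λ κ κ′ {A} {A′} _ _ → attach-injective κ κ′ {A} {A′}) is u
      (λ {κ} {A} κ∈ (c , obeys) → config κ∈ c , attach-uses κ {A} obeys) complete)

  perfect-step : ∀ e → #allUsed (suc e) (suc (suc (2 * e))) ≡ suc (2 * e) * #allUsed e (2 * e)
  perfect-step e = begin
    #allUsed (suc e) (suc n)                          ≡⟨ #allUsed-by-kinds is (UP.map⁺ (λ { refl → refl }) (UP.allFin⁺ n)) config complete ⟩
    sum (map (sliceCount e) is)                    ≡⟨ sum-map-const (sliceCount e) is paired-count ⟩
    length is * (#allUsed e n + #allUsed e (2 * e))
      ≡⟨ cong₂ (λ l z → l * (z + #allUsed e (2 * e))) length-is (#allUsed-vanishes (≤-refl {suc (2 * e)})) ⟩
    n * #allUsed e (2 * e)                            ∎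
    where
    open ≡-Reasoning
    n = suc (2 * e)
    is = map paired (L.allFin n)
    length-is : length is ≡ n
    length-is = trans (LP.length-map paired (L.allFin n)) (LP.length-tabulate id)
    config : ∀ {κ A} → κ ∈ is → Config (sliceExtras e κ) A → Config (suc e) (attach κ A)
    config {A = A} κ∈ c with MP.∈-map⁻ paired κ∈
    ... | (j , _ , refl) = subst (λ k → Config k (attach (paired j) A)) (+-comm e 1) (attach-Config (paired j) c)
    complete : ∀ {B} → ConfigOn (suc e) allRequired B → ∃ λ κ → κ ∈ is × SliceOf e κ (slice 0 B) × attach κ (slice 0 B) ≡ B
    complete {B} (c , used) =
      let (j , s , eq) = Classify.classify-perfect B c used refl in paired j , MP.∈-map⁺ paired (MP.∈-allFin j) , s , eq
    paired-count : ∀ {κ} → κ ∈ is → sliceCount e κ ≡ #allUsed e n + #allUsed e (2 * e)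
    paired-count κ∈ with MP.∈-map⁻ paired κ∈
    ... | (j , _ , refl) = count-free-at j

  nearPerfect-step : ∀ e → #allUsed (suc e) (suc (2 * e))
    ≡ 2 * e * (#allUsed e (2 * e) + #allUsed e (2 * e ∸ 1)) + (((2 * e) C 2) * #allUsed (e ∸ 1) (2 * e ∸ 2) + #allUsed e (2 * e))
  nearPerfect-step e = begin
    #allUsed (suc e) (suc n)                                   ≡⟨ #allUsed-by-kinds (kinds n) (kinds-unique n) config complete ⟩
    sum (map (sliceCount e) (map paired (L.allFin n) ++ map forked (forks n) ++ squared ∷ []))
      ≡⟨ cong sum (LP.map-++ (sliceCount e) (map paired (L.allFin n)) _) ⟩
    sum (map (sliceCount e) (map paired (L.allFin n)) ++ map (sliceCount e) (map forked (forks n) ++ squared ∷ []))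
      ≡⟨ sum-++ (map (sliceCount e) (map paired (L.allFin n))) _ ⟩
    sum (map (sliceCount e) (map paired (L.allFin n))) + sum (map (sliceCount e) (map forked (forks n) ++ squared ∷ []))
      ≡⟨ cong₂ _+_ (sum-map-const (sliceCount e) (map paired (L.allFin n)) paired-count) (trans (cong sum (LP.map-++ (sliceCount e) (map forked (forks n)) _))
                     (sum-++ (map (sliceCount e) (map forked (forks n))) _)) ⟩
    length (map paired (L.allFin n)) * (#allUsed e n + #allUsed e (n ∸ 1))
      + (sum (map (sliceCount e) (map forked (forks n))) + (#allUsed e n + 0))
      ≡⟨ cong₂ (λ l s → l * (#allUsed e n + #allUsed e (n ∸ 1)) + (s + (#allUsed e n + 0)))
               (trans (LP.length-map paired (L.allFin n)) (LP.length-tabulate {n = n} id))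
               (sum-map-const (sliceCount e) (map forked (forks n)) forked-count) ⟩
    n * (#allUsed e n + #allUsed e (n ∸ 1)) + (length (map forked (forks n)) * #allUsed (e ∸ 1) (n ∸ 2) + (#allUsed e n + 0))
      ≡⟨ cong₂ (λ l s → n * (#allUsed e n + #allUsed e (n ∸ 1)) + (l * #allUsed (e ∸ 1) (n ∸ 2) + s))
               (trans (LP.length-map forked (forks n)) (length-forks n)) (+-identityʳ _) ⟩
    n * (#allUsed e n + #allUsed e (n ∸ 1)) + ((n C 2) * #allUsed (e ∸ 1) (n ∸ 2) + #allUsed e n) ∎
    where
    open ≡-Reasoning
    n = 2 * e
    config : ∀ {κ A} → κ ∈ kinds n → Config (sliceExtras e κ) A → Config (suc e) (attach κ A)
    config {paired j} {A} _ c = subst (λ k → Config k (attach (paired j) A)) (+-comm e 1) (attach-Config (paired j) c)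
    config {forked f} {A} _ c = subst (λ k → Config k (attach (forked f) A)) (forked-extras e f) (attach-Config (forked f) c)
    config {squared}  {A} _ c = subst (λ k → Config k (attach squared A)) (+-comm e 1) (attach-Config squared c)
    complete : ∀ {B} → ConfigOn (suc e) allRequired B → ∃ λ κ → κ ∈ kinds n × SliceOf e κ (slice 0 B) × attach κ (slice 0 B) ≡ B
    complete {B} (c , used) = Classify.classify-nearPerfect B c used refl
    paired-count : ∀ {κ} → κ ∈ map paired (L.allFin n) → sliceCount e κ ≡ #allUsed e n + #allUsed e (n ∸ 1)
    paired-count κ∈ with MP.∈-map⁻ paired κ∈
    ... | (j , _ , refl) = count-free-at j
    forked-count : ∀ {κ} → κ ∈ map forked (forks n) → sliceCount e κ ≡ #allUsed (e ∸ 1) (n ∸ 2)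
    forked-count κ∈ with MP.∈-map⁻ forked κ∈
    ... | (f@(fork j k _) , _ , refl) = count-forbidden-pair (fork-distinct f)

  #allUsed-perfect : ∀ e → #allUsed e (2 * e) ≡ (2 * e ∸ 1) !!
  #allUsed-perfect zero    = #allUsed-empty
  #allUsed-perfect (suc e) = begin
    #allUsed (suc e) (2 * suc e)            ≡⟨ cong (#allUsed (suc e)) (*-suc 2 e) ⟩
    #allUsed (suc e) (suc (suc (2 * e)))    ≡⟨ perfect-step e ⟩
    suc (2 * e) * #allUsed e (2 * e)        ≡⟨ cong (suc (2 * e) *_) (#allUsed-perfect e) ⟩
    suc (2 * e) * (2 * e ∸ 1) !!         ≡⟨ !!-odd e ⟨
    (2 * suc e ∸ 1) !!                   ∎
    where open ≡-Reasoning

  #allUsed-nearPerfect : ∀ e → #allUsed (suc e) (suc (2 * e)) ≡ suc e * (2 * suc e ∸ 1) !!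
  #allUsed-nearPerfect zero    = trans (nearPerfect-step 0) #allUsed-empty
  #allUsed-nearPerfect (suc e) = begin
    #allUsed (suc (suc e)) (suc (2 * suc e))
      ≡⟨ nearPerfect-step (suc e) ⟩
    2 * suc e * (#allUsed (suc e) (2 * suc e) + #allUsed (suc e) (2 * suc e ∸ 1))
      + (((2 * suc e) C 2) * #allUsed e (2 * suc e ∸ 2) + #allUsed (suc e) (2 * suc e))
      ≡⟨ cong₂ (λ x y → 2 * suc e * (x + y) + (((2 * suc e) C 2) * #allUsed e (2 * suc e ∸ 2) + x)) P≡ N≡ ⟩
    2 * suc e * (suc (2 * e) * D + suc e * (suc (2 * e) * D))
      + (((2 * suc e) C 2) * #allUsed e (2 * suc e ∸ 2) + suc (2 * e) * D)
      ≡⟨ cong₂ (λ x y → 2 * suc e * (suc (2 * e) * D + suc e * (suc (2 * e) * D)) + (x * y + suc (2 * e) * D)) (C2-double e) D≡ ⟩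
    2 * suc e * (suc (2 * e) * D + suc e * (suc (2 * e) * D)) + (suc e * suc (2 * e) * D + suc (2 * e) * D)
      ≡⟨ regroup e D ⟩
    suc (suc e) * (suc (2 * suc e) * (suc (2 * e) * D))
      ≡⟨ cong (λ x → suc (suc e) * (suc (2 * suc e) * x)) (!!-odd e) ⟨
    suc (suc e) * (suc (2 * suc e) * (2 * suc e ∸ 1) !!)
      ≡⟨ cong (suc (suc e) *_) (!!-odd (suc e)) ⟨
    suc (suc e) * (2 * suc (suc e) ∸ 1) !! ∎
    where
    open ≡-Reasoning
    D = (2 * e ∸ 1) !!
    P≡ : #allUsed (suc e) (2 * suc e) ≡ suc (2 * e) * D
    P≡ = trans (#allUsed-perfect (suc e)) (!!-odd e)
    N≡ : #allUsed (suc e) (2 * suc e ∸ 1) ≡ suc e * (suc (2 * e) * D)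
    N≡ = trans (cong (λ m → #allUsed (suc e) (m ∸ 1)) (*-suc 2 e)) (trans (#allUsed-nearPerfect e) (cong (suc e *_) (!!-odd e)))
    D≡ : #allUsed e (2 * suc e ∸ 2) ≡ D
    D≡ = trans (cong (λ m → #allUsed e (m ∸ 2)) (*-suc 2 e)) (#allUsed-perfect e)
    regroup : ∀ e D → 2 * suc e * (suc (2 * e) * D + suc e * (suc (2 * e) * D)) + (suc e * suc (2 * e) * D + suc (2 * e) * D)
                      ≡ suc (suc e) * (suc (2 * suc e) * (suc (2 * e) * D))
    regroup = ℕ-Solver.solve-∀

γ≡binConv : ∀ y e h → γ y e h ≡ binConv (suc (2 * e)) (λ j → + y (suc j) (suc (suc j + e))) h
γ≡binConv y e h = trans (cong (λ M → binConv M (λ j → + y (j + 1) (j + e + 2)) h) (+-comm (2 * e) 1))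
  (binConv-cong (suc (2 * e)) h (λ j → cong₂ (λ k d → + y k d) (+-comm j 1) (+-comm (j + e) 2)))

corollary3p5 : (y : ℕ → ℕ → ℕ) → (∀ k d → IsY k d (y k d)) →
    (e : ℕ) → 0 < e →
      (sumℤ (2 * e) (λ i → γ y e i) ≡ + ((2 * e ∸ 1) !!))
      × (sumℤ (2 * e) (λ i → + (i + 1) *ℤ γ y e i) ≡ + (e * ((2 * e ∸ 1) !!)))
corollary3p5 y hy (suc e) _ = sum≡ , weighted-sum≡
  where
  open Counts y hy
  open FiniteDifference (λ n → y n (suc (n + suc e))) (prefixCount (suc e)) (prefixCount-zero (suc e)) (prefixCount-suc (suc e))
  -- 2 * suc e reduces to suc N₀.
  N₀ = e + suc (e + 0)
  D = (2 * suc e ∸ 1) !!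
  γ≗ : ∀ h → γ y (suc e) h ≡ binConv (suc (2 * suc e)) (λ j → + y (suc j) (suc (suc j + suc e))) h
  γ≗ = γ≡binConv y (suc e)
  T-perfect : prefixCount (suc e) (suc N₀) (suc N₀) ≡ D
  T-perfect = trans (prefixCount-diagonal (suc e) (suc N₀)) (#allUsed-perfect (suc e))
  T-nearPerfect : prefixCount (suc e) N₀ N₀ ≡ suc e * D
  T-nearPerfect = trans (prefixCount-diagonal (suc e) N₀) (trans (cong (#allUsed (suc e)) (+-suc e (e + 0))) (#allUsed-nearPerfect e))
  sum≡ : sumℤ (2 * suc e) (γ y (suc e)) ≡ + D
  sum≡ = trans (sumℤ-cong (2 * suc e) (λ h _ → γ≗ h)) (trans (sum-binConv≡Q (y-dim0 e) N₀) (cong +_ T-perfect))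
  partialSums≡ : sumℤ (suc (2 * suc e)) (λ i → sumℤ i (γ y (suc e))) ≡ + (D + suc e * D)
  partialSums≡ = trans (sumℤ-cong (suc (2 * suc e)) (λ i _ → sumℤ-cong i (λ h _ → γ≗ h)))
    (trans (sum-partialSums≡Q (y-dim0 e) N₀) (cong +_ (cong₂ _+_ T-perfect T-nearPerfect)))
  weighted-sum≡ : sumℤ (2 * suc e) (λ h → + (h + 1) *ℤ γ y (suc e) h) ≡ + (suc e * D)
  weighted-sum≡ = sumℤ-weighted-value (2 * suc e) (γ y (suc e)) sum≡ partialSums≡ (total (suc e) D)
    where
    total : ∀ e D → (2 * e + 1) * D ≡ (D + e * D) + e * D
    total = ℕ-Solver.solve-∀
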